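{- For any rooted tree $T^r$ in which the root $r$ has $d$ children, $$D^{\mathrm{pr}}_{\max}(T^r)=\sum_{i=1}^{d} D^{\mathrm{pr}}_{\max}(T^r_i)+\sum_{i=1}^{d}\sum_{j=1}^{i} n_j,$$ where $T^r_1,\dots,T^r_d$ are the immediate subtrees of $T^r$ (each rooted at the corresponding child of $r$) ordered so that their sizes satisfy $n_1\ge n_2\ge\cdots\ge n_d$, $n_j$ being the number of vertices of $T^r_j$.
   Context: A linear arrangement of a graph $G=(V,E)$ with $n=|V|$ is a bijection $\pi:V\to\{1,\dots,n\}$; the cost of $\pi$ is $\sum_{uv\in E}|\pi(u)-\pi(v)|$. Two edges $st,uv$ with $\pi(s)<\pi(t)$, $\pi(u)<\pi(v)$, $\pi(s)<\pi(u)$ cross if $\pi(s)<\pi(u)<\pi(t)<\pi(v)$; an arrangement is planar if no two edges cross. For a tree rooted at $r$, an arrangement is projective if it is planar and there is no edge $uv$ with $\min(\pi(u),\pi(v))<\pi(r)<\max(\pi(u),\pi(v))$. $D^{\mathrm{pr}}_{\max}(T^r)$ denotes the maximum cost over all projective arrangements of the rooted tree $T^r$ (equal to $0$ for a single vertex). The immediate subtrees of $T^r$ are the subtrees rooted at the children of $r$, each consisting of a child and all its descendants. -}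

module Defs where

open import Data.Nat using (ℕ; zero; suc; _+_; _*_; _<_; _≤_; ∣_-_∣; _⊓_; _⊔_)
open import Data.Fin using (Fin; toℕ)
open import Data.List using (List; []; _∷_; map; _++_; inits)
open import Data.Nat.ListAction using (sum)
open import Data.List.Relation.Unary.Any using (Any; here; there)
open import Data.List.Relation.Unary.Linked using (Linked)
open import Data.List.Relation.Binary.Pointwise using (Pointwise)
open import Data.List.Relation.Binary.Permutation.Propositional using (_↭_)
open import Data.List.Membership.Propositional using (_∈_)
open import Data.Product using (_×_; _,_; proj₁; proj₂; Σ; ∃)
open import Relation.Nullary using (¬_)
open import Function.Definitions using (Bijective)
open import Relation.Binary.PropositionalEquality using (_≡_)

-- Rooted (ordered-list) trees: a node with its list of immediate subtrees.
-- The order of the list is irrelevant for the notions below (only used to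
-- index vertices).
data Tree : Set where
  node : List Tree → Tree

data Pos : Tree → Set where
  root : ∀ {ts} → Pos (node ts)
  sub  : ∀ {ts} → Any Pos ts → Pos (node ts)

mutual
  size : Tree → ℕ
  size (node ts) = suc (sizes ts)

  sizes : List Tree → ℕ
  sizes []       = 0
  sizes (t ∷ ts) = size t + sizes ts

childRoots : (ts : List Tree) → List (Any Pos ts)
childRoots []            = []
childRoots (node _ ∷ ts) = here root ∷ map there (childRoots ts)

mutual
  edges : (t : Tree) → List (Pos t × Pos t)
  edges (node ts) =
    map (λ c → root , sub c) (childRoots ts)
    ++ map (λ e → sub (proj₁ e) , sub (proj₂ e)) (edgesF ts)

  edgesF : (ts : List Tree) → List (Any Pos ts × Any Pos ts)
  edgesF []       = []
  edgesF (t ∷ ts) =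
    map (λ e → here (proj₁ e) , here (proj₂ e)) (edges t)
    ++ map (λ e → there (proj₁ e) , there (proj₂ e)) (edgesF ts)

-- A linear arrangement: a bijection from the vertices onto the n positions
-- (positions 0..n-1 instead of 1..n; costs and crossings are shift invariant).
record Arrangement (t : Tree) : Set where
  field
    π   : Pos t → Fin (size t)
    bij : Bijective _≡_ _≡_ π
open Arrangement public

pos : ∀ {t} → Arrangement t → Pos t → ℕ
pos a v = toℕ (π a v)

cost : ∀ {t} → Arrangement t → ℕ
cost {t} a = sum (map (λ e → ∣ pos a (proj₁ e) - pos a (proj₂ e) ∣) (edges t))

Cross : ∀ {t} → Arrangement t → Pos t × Pos t → Pos t × Pos t → Set
Cross a e f =
  let s = pos a (proj₁ e) ⊓ pos a (proj₂ e)
      t = pos a (proj₁ e) ⊔ pos a (proj₂ e)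
      u = pos a (proj₁ f) ⊓ pos a (proj₂ f)
      v = pos a (proj₁ f) ⊔ pos a (proj₂ f)
  in (s < u) × (u < t) × (t < v)

Planar : ∀ {t} → Arrangement t → Set
Planar {t} a = ∀ e f → e ∈ edges t → f ∈ edges t → ¬ Cross a e f

Covers : ∀ {t} → Arrangement t → Pos t × Pos t → Pos t → Set
Covers a e r =
  ((pos a (proj₁ e) ⊓ pos a (proj₂ e)) < pos a r)
  × (pos a r < (pos a (proj₁ e) ⊔ pos a (proj₂ e)))

Projective : ∀ {t} → Arrangement t → Set
Projective {node ts} a = Planar a × (∀ e → e ∈ edges (node ts) → ¬ Covers a e root)

-- m is the maximum cost over all projective arrangements of t (= D^pr_max(t)).
IsMaxProj : Tree → ℕ → Set
IsMaxProj t m =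
  (Σ (Arrangement t) λ a → Projective a × cost a ≡ m)
  × (∀ (a : Arrangement t) → Projective a → cost a ≤ m)

-- Σ_{i=1}^{d} Σ_{j=1}^{i} n_j  (the empty prefix contributes 0).
prefixSumsSum : List ℕ → ℕ
prefixSumsSum ns = sum (map sum (inits ns))

-- Label the vertices injectively by natural numbers and let an edge cost one
-- more than the number of labels strictly between its ends.  An arrangement,
-- labelled by positions, costs at most this; conversely a labelling is
-- realised, through ranks, by an arrangement costing at least this, and
-- projectivity passes both ways.  So it suffices to study projective labellings.
--
-- In a projective labelling neither the root nor a vertex of another subtree
-- lies under an edge of an immediate subtree, so the cost is the sum of the
-- costs of the subtrees plus that of the root edges.  The edge to child i
-- covers at most n_i - 1 vertices of its own subtree, and for i ≠ j at most one
-- of the edges to children i and j covers vertices of the other's subtree (else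
-- each child would lie between the root and the other), at most max(n_i, n_j)
-- of them.  Hence the cost is at most
-- D(T) = Σ D(T_i) + Σ_i n_i + Σ_{i<j} max(n_i, n_j), and placing the subtrees
-- on one side of the root by decreasing size, each reversed so that its root
-- is farthest out, attains every one of these bounds.  For n_1 ≥ … ≥ n_d,
-- Σ_i n_i + Σ_{i<j} max(n_i, n_j) = Σ_i Σ_{j≤i} n_j.

module Submission where

open import Data.Nat
open import Data.Nat.Properties
open import Data.Nat.ListAction using (sum)
open import Data.Nat.ListAction.Properties using (sum-++; sum-↭)
open import Data.Nat.Solver using (module +-*-Solver)
open import Data.Fin as Fin using (Fin; zero; suc; toℕ; fromℕ<)
open import Data.Fin.Properties using (toℕ-fromℕ<; toℕ-injective; toℕ<n) renaming (suc-injective to Fin-suc-injective)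
open import Data.List using (List; []; _∷_; map; _++_; inits; length; lookup; upTo; allFin)
open import Data.List.Properties using (map-∘; map-++; map-cong; length-map; length-++; length-upTo; length-tabulate)
open import Data.List.Relation.Unary.Any as Any using (Any; here; there)
open import Data.List.Relation.Unary.Any.Properties using (here-injective; there-injective)
open import Data.List.Relation.Unary.All as All using (All; []; _∷_)
open import Data.List.Relation.Unary.AllPairs using ([]; _∷_)
open import Data.List.Relation.Unary.Linked as Linked using (Linked; _∷_)
open import Data.List.Relation.Unary.Linked.Properties using (Linked⇒All) renaming (map⁺ to Linked-map⁺)
open import Data.List.Relation.Unary.Unique.Propositional using (Unique)
open import Data.List.Relation.Unary.Unique.Propositional.Properties
  using (upTo⁺) renaming (map⁺ to Unique-map⁺; ++⁺ to Unique-++⁺)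
open import Data.List.Relation.Binary.Disjoint.Propositional using (Disjoint)
open import Data.List.Relation.Binary.Pointwise using (Pointwise; []; _∷_)
open import Data.List.Relation.Binary.Permutation.Propositional as Perm using (_↭_)
open import Data.List.Relation.Binary.Permutation.Propositional.Properties using () renaming (map⁺ to ↭-map⁺)
open import Data.List.Membership.Propositional using (_∈_)
open import Data.List.Membership.Propositional.Properties
  using (∈-map⁺; ∈-map⁻; ∈-++⁺ˡ; ∈-++⁺ʳ; ∈-++⁻; ∈-∃++; ∈-upTo⁻; ∈-allFin)
open import Data.Product using (_×_; _,_; proj₁; proj₂; ∃)
open import Data.Sum using (_⊎_; inj₁; inj₂; [_,_])
open import Data.Empty using (⊥; ⊥-elim)
open import Function using (_∘_)
open import Function.Definitions using (Injective)
open import Relation.Nullary using (¬_; Dec; yes; no; ¬?)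
open import Relation.Nullary.Decidable using (_×-dec_; _⊎-dec_)
open import Relation.Binary using (tri<; tri≈; tri>)
open import Relation.Binary.PropositionalEquality
  using (_≡_; _≢_; refl; sym; trans; cong; cong₂; subst; subst₂; module ≡-Reasoning)
open import Algebra.Properties.CommutativeSemigroup +-commutativeSemigroup
  using () renaming (interchange to +-interchange)
open import Defs

open +-*-Solver using (solve; _:+_; _:=_)

Between : ℕ → ℕ → ℕ → Set
Between a b c = (a < b × b < c) ⊎ (c < b × b < a)

Outside : ℕ → ℕ → ℕ → Set
Outside a c b = (b < a × b < c) ⊎ (a < b × c < b)

Separates : ℕ → ℕ → ℕ → ℕ → Set
Separates a b c d = (Between a c b × Outside a b d) ⊎ (Between a d b × Outside a b c)

Crosses : ℕ → ℕ → ℕ → ℕ → Set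
Crosses a b c d = (a ⊓ b < c ⊓ d) × (c ⊓ d < a ⊔ b) × (a ⊔ b < c ⊔ d)

between? : ∀ a b c → Dec (Between a b c)
between? a b c = ((a <? b) ×-dec (b <? c)) ⊎-dec ((c <? b) ×-dec (b <? a))

Between-sym : ∀ {a b c} → Between a b c → Between c b a
Between-sym (inj₁ p) = inj₂ p
Between-sym (inj₂ p) = inj₁ p

Between-irrefl : ∀ {a b} → ¬ Between a b a
Between-irrefl (inj₁ (p , q)) = <-asym p q
Between-irrefl (inj₂ (p , q)) = <-asym p q

Between⇒≢ˡ : ∀ {a b c} → Between a b c → b ≢ a
Between⇒≢ˡ (inj₁ (p , _)) refl = <-irrefl refl p
Between⇒≢ˡ (inj₂ (_ , q)) refl = <-irrefl refl q

Between⇒≢ʳ : ∀ {a b c} → Between a b c → b ≢ c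
Between⇒≢ʳ p = Between⇒≢ˡ (Between-sym p)

Between-asym : ∀ {r a b} → Between r a b → ¬ Between r b a
Between-asym (inj₁ (_ , y)) (inj₁ (_ , q)) = <-asym y q
Between-asym (inj₁ (x , y)) (inj₂ (_ , q)) = <-asym (<-trans x y) q
Between-asym (inj₂ (x , y)) (inj₁ (p , _)) = <-asym p (<-trans x y)
Between-asym (inj₂ (x , _)) (inj₂ (p , _)) = <-asym x p

Between-split : ∀ {a p b} c → Between a p b → c ≢ p → Between a p c ⊎ Between c p b
Between-split {p = p} c (inj₁ (x , y)) c≢p with <-cmp c p
... | tri< c<p _ _ = inj₂ (inj₁ (c<p , y))
... | tri≈ _ c≡p _ = ⊥-elim (c≢p c≡p)
... | tri> _ _ p<c = inj₁ (inj₁ (x , p<c))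
Between-split {p = p} c (inj₂ (x , y)) c≢p with <-cmp c p
... | tri< c<p _ _ = inj₁ (inj₂ (c<p , y))
... | tri≈ _ c≡p _ = ⊥-elim (c≢p c≡p)
... | tri> _ _ p<c = inj₂ (inj₂ (x , p<c))

¬Between⇒Outside : ∀ {a p c n} → Between a p c → ¬ Between a n c → n ≢ a → n ≢ c → Outside a c n
¬Between⇒Outside {a} {c = c} {n} (inj₁ (x , y)) n∉ n≢a n≢c with <-cmp n a | <-cmp n c
... | tri< n<a _ _ | _           = inj₁ (n<a , <-trans n<a (<-trans x y))
... | tri≈ _ n≡a _ | _           = ⊥-elim (n≢a n≡a)
... | tri> _ _ a<n | tri< n<c _ _ = ⊥-elim (n∉ (inj₁ (a<n , n<c)))
... | tri> _ _ _   | tri≈ _ n≡c _ = ⊥-elim (n≢c n≡c)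
... | tri> _ _ a<n | tri> _ _ c<n = inj₂ (a<n , c<n)
¬Between⇒Outside {a} {c = c} {n} (inj₂ (x , y)) n∉ n≢a n≢c with <-cmp n a | <-cmp n c
... | _            | tri< n<c _ _ = inj₁ (<-trans n<c (<-trans x y) , n<c)
... | _            | tri≈ _ n≡c _ = ⊥-elim (n≢c n≡c)
... | tri< n<a _ _ | tri> _ _ c<n = ⊥-elim (n∉ (inj₂ (c<n , n<a)))
... | tri≈ _ n≡a _ | tri> _ _ _   = ⊥-elim (n≢a n≡a)
... | tri> _ _ a<n | tri> _ _ c<n = inj₂ (a<n , c<n)

Between-confined : ∀ {r w c c′} → Between r w c → ¬ Between w r c′ → ¬ Between w c c′ →
                   c′ ≢ r → c′ ≢ c → Between r c′ c
Between-confined {r} {c = c} {c′} (inj₁ (x , y)) r∉ c∉ c′≢r c′≢c with <-cmp c′ r | <-cmp c′ c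
... | tri< c′<r _ _ | _              = ⊥-elim (r∉ (inj₂ (c′<r , x)))
... | tri≈ _ c′≡r _ | _              = ⊥-elim (c′≢r c′≡r)
... | tri> _ _ _    | tri≈ _ c′≡c _  = ⊥-elim (c′≢c c′≡c)
... | tri> _ _ _    | tri> _ _ c<c′  = ⊥-elim (c∉ (inj₁ (y , c<c′)))
... | tri> _ _ r<c′ | tri< c′<c _ _  = inj₁ (r<c′ , c′<c)
Between-confined {r} {c = c} {c′} (inj₂ (x , y)) r∉ c∉ c′≢r c′≢c with <-cmp c′ r | <-cmp c′ c
... | tri> _ _ r<c′ | _              = ⊥-elim (r∉ (inj₁ (y , r<c′)))
... | tri≈ _ c′≡r _ | _              = ⊥-elim (c′≢r c′≡r)
... | tri< _ _ _    | tri≈ _ c′≡c _  = ⊥-elim (c′≢c c′≡c)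
... | tri< _ _ _    | tri< c′<c _ _  = ⊥-elim (c∉ (inj₂ (c′<c , x)))
... | tri< c′<r _ _ | tri> _ _ c<c′  = inj₂ (c<c′ , c′<r)

Crosses⇒Separates : ∀ a b c d → Crosses a b c d → Separates a b c d
Crosses⇒Separates a b c d (p , q , r) with ≤-total a b | ≤-total c d
... | inj₁ a≤b | inj₁ c≤d
  rewrite m≤n⇒m⊓n≡m a≤b | m≤n⇒m⊔n≡n a≤b | m≤n⇒m⊓n≡m c≤d | m≤n⇒m⊔n≡n c≤d
  = inj₁ (inj₁ (p , q) , inj₂ (<-≤-trans p c≤d , r))
... | inj₁ a≤b | inj₂ d≤c
  rewrite m≤n⇒m⊓n≡m a≤b | m≤n⇒m⊔n≡n a≤b | m≥n⇒m⊓n≡n d≤c | m≥n⇒m⊔n≡m d≤c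
  = inj₂ (inj₁ (p , q) , inj₂ (<-≤-trans p d≤c , r))
... | inj₂ b≤a | inj₁ c≤d
  rewrite m≥n⇒m⊓n≡n b≤a | m≥n⇒m⊔n≡m b≤a | m≤n⇒m⊓n≡m c≤d | m≤n⇒m⊔n≡n c≤d
  = inj₁ (inj₂ (p , q) , inj₂ (r , <-≤-trans p c≤d))
... | inj₂ b≤a | inj₂ d≤c
  rewrite m≥n⇒m⊓n≡n b≤a | m≥n⇒m⊔n≡m b≤a | m≥n⇒m⊓n≡n d≤c | m≥n⇒m⊔n≡m d≤c
  = inj₂ (inj₂ (p , q) , inj₂ (r , <-≤-trans p d≤c))

Between×Outside⇒Crosses : ∀ a b c d → Between a c b → Outside a b d → Crosses a b c d ⊎ Crosses c d a b
Between×Outside⇒Crosses a b c d (inj₁ (x , y)) (inj₁ (z , _))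
  rewrite m≤n⇒m⊓n≡m (<⇒≤ (<-trans x y)) | m≤n⇒m⊔n≡n (<⇒≤ (<-trans x y))
        | m≥n⇒m⊓n≡n (<⇒≤ (<-trans z x)) | m≥n⇒m⊔n≡m (<⇒≤ (<-trans z x))
  = inj₂ (z , x , y)
Between×Outside⇒Crosses a b c d (inj₁ (x , y)) (inj₂ (_ , w))
  rewrite m≤n⇒m⊓n≡m (<⇒≤ (<-trans x y)) | m≤n⇒m⊔n≡n (<⇒≤ (<-trans x y))
        | m≤n⇒m⊓n≡m (<⇒≤ (<-trans y w)) | m≤n⇒m⊔n≡n (<⇒≤ (<-trans y w))
  = inj₁ (x , y , w)
Between×Outside⇒Crosses a b c d (inj₂ (x , y)) (inj₁ (_ , w))
  rewrite m≥n⇒m⊓n≡n (<⇒≤ (<-trans x y)) | m≥n⇒m⊔n≡m (<⇒≤ (<-trans x y))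
        | m≥n⇒m⊓n≡n (<⇒≤ (<-trans w x)) | m≥n⇒m⊔n≡m (<⇒≤ (<-trans w x))
  = inj₂ (w , x , y)
Between×Outside⇒Crosses a b c d (inj₂ (x , y)) (inj₂ (z , _))
  rewrite m≥n⇒m⊓n≡n (<⇒≤ (<-trans x y)) | m≥n⇒m⊔n≡m (<⇒≤ (<-trans x y))
        | m≤n⇒m⊓n≡m (<⇒≤ (<-trans y z)) | m≤n⇒m⊔n≡n (<⇒≤ (<-trans y z))
  = inj₁ (x , y , z)

Separates⇒Crosses : ∀ a b c d → Separates a b c d → Crosses a b c d ⊎ Crosses c d a b
Separates⇒Crosses a b c d (inj₁ (btw , out)) = Between×Outside⇒Crosses a b c d btw out
Separates⇒Crosses a b c d (inj₂ (btw , out))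
  with Between×Outside⇒Crosses a b d c btw out
... | crosses rewrite ⊓-comm d c | ⊔-comm d c = crosses

⊓<⊔⇒Between : ∀ a b r → a ⊓ b < r → r < a ⊔ b → Between a r b
⊓<⊔⇒Between a b r p q with ≤-total a b
... | inj₁ a≤b rewrite m≤n⇒m⊓n≡m a≤b | m≤n⇒m⊔n≡n a≤b = inj₁ (p , q)
... | inj₂ b≤a rewrite m≥n⇒m⊓n≡n b≤a | m≥n⇒m⊔n≡m b≤a = inj₂ (p , q)

Between⇒⊓<⊔ : ∀ a b r → Between a r b → a ⊓ b < r × r < a ⊔ b
Between⇒⊓<⊔ a b r (inj₁ (x , y))
  rewrite m≤n⇒m⊓n≡m (<⇒≤ (<-trans x y)) | m≤n⇒m⊔n≡n (<⇒≤ (<-trans x y)) = x , y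
Between⇒⊓<⊔ a b r (inj₂ (x , y))
  rewrite m≥n⇒m⊓n≡n (<⇒≤ (<-trans x y)) | m≥n⇒m⊔n≡m (<⇒≤ (<-trans x y)) = x , y

module Transport {A : Set} {g h : A → ℕ} (reflects : ∀ {x y} → g x < g y → h x < h y) where

  Between-transport : ∀ x y z → Between (g x) (g y) (g z) → Between (h x) (h y) (h z)
  Between-transport _ _ _ (inj₁ (p , q)) = inj₁ (reflects p , reflects q)
  Between-transport _ _ _ (inj₂ (p , q)) = inj₂ (reflects p , reflects q)

  Outside-transport : ∀ x z y → Outside (g x) (g z) (g y) → Outside (h x) (h z) (h y)
  Outside-transport _ _ _ (inj₁ (p , q)) = inj₁ (reflects p , reflects q)
  Outside-transport _ _ _ (inj₂ (p , q)) = inj₂ (reflects p , reflects q)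

  Separates-transport : ∀ w x y z → Separates (g w) (g x) (g y) (g z) → Separates (h w) (h x) (h y) (h z)
  Separates-transport w x y z (inj₁ (btw , out)) = inj₁ (Between-transport w y x btw , Outside-transport w x z out)
  Separates-transport w x y z (inj₂ (btw , out)) = inj₂ (Between-transport w z x btw , Outside-transport w x y out)

module ReverseTransport {A : Set} {g h : A → ℕ} (reverses : ∀ {x y} → g x < g y → h y < h x) where

  Between-reverse : ∀ x y z → Between (g x) (g y) (g z) → Between (h x) (h y) (h z)
  Between-reverse _ _ _ (inj₁ (p , q)) = inj₂ (reverses q , reverses p)
  Between-reverse _ _ _ (inj₂ (p , q)) = inj₁ (reverses q , reverses p)

  Outside-reverse : ∀ x z y → Outside (g x) (g z) (g y) → Outside (h x) (h z) (h y)
  Outside-reverse _ _ _ (inj₁ (p , q)) = inj₂ (reverses p , reverses q)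
  Outside-reverse _ _ _ (inj₂ (p , q)) = inj₁ (reverses p , reverses q)

  Separates-reverse : ∀ w x y z → Separates (g w) (g x) (g y) (g z) → Separates (h w) (h x) (h y) (h z)
  Separates-reverse w x y z (inj₁ (btw , out)) = inj₁ (Between-reverse w y x btw , Outside-reverse w x z out)
  Separates-reverse w x y z (inj₂ (btw , out)) = inj₂ (Between-reverse w z x btw , Outside-reverse w x y out)

∑ : ∀ {d} → (Fin d → ℕ) → ℕ
∑ {zero}  f = 0
∑ {suc d} f = f zero + ∑ (f ∘ suc)

-- ∑< B = Σ_{i<j} B i j
∑< : ∀ {d} → (Fin d → Fin d → ℕ) → ℕ
∑< {zero}  B = 0
∑< {suc d} B = ∑ (B zero ∘ suc) + ∑< (λ i j → B (suc i) (suc j))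

∑-cong : ∀ {d} {f g : Fin d → ℕ} → (∀ i → f i ≡ g i) → ∑ f ≡ ∑ g
∑-cong {zero}  f≡g = refl
∑-cong {suc d} f≡g = cong₂ _+_ (f≡g zero) (∑-cong (f≡g ∘ suc))

∑-mono : ∀ {d} {f g : Fin d → ℕ} → (∀ i → f i ≤ g i) → ∑ f ≤ ∑ g
∑-mono {zero}  f≤g = z≤n
∑-mono {suc d} f≤g = +-mono-≤ (f≤g zero) (∑-mono (f≤g ∘ suc))

∑-distrib-+ : ∀ {d} (f g : Fin d → ℕ) → ∑ (λ i → f i + g i) ≡ ∑ f + ∑ g
∑-distrib-+ {zero}  f g = refl
∑-distrib-+ {suc d} f g rewrite ∑-distrib-+ (f ∘ suc) (g ∘ suc) =
  +-interchange (f zero) (g zero) (∑ (f ∘ suc)) (∑ (g ∘ suc))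

∑-zero : ∀ {d} (f : Fin d → ℕ) → (∀ i → f i ≡ 0) → ∑ f ≡ 0
∑-zero {zero}  f f≡0 = refl
∑-zero {suc d} f f≡0 rewrite f≡0 zero = ∑-zero (f ∘ suc) (f≡0 ∘ suc)

∑-single : ∀ {d} (f : Fin d → ℕ) i → (∀ j → j ≢ i → f j ≡ 0) → ∑ f ≡ f i
∑-single f zero f≡0 =
  trans (cong (f zero +_) (∑-zero (f ∘ suc) λ j → f≡0 (suc j) λ ())) (+-identityʳ _)
∑-single f (suc i) f≡0 rewrite f≡0 zero (λ ()) =
  ∑-single (f ∘ suc) i λ j j≢i → f≡0 (suc j) (j≢i ∘ Fin-suc-injective)

∑<-mono : ∀ {d} {B C : Fin d → Fin d → ℕ} → (∀ i j → i ≢ j → B i j ≤ C i j) → ∑< B ≤ ∑< C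
∑<-mono {zero}  B≤C = z≤n
∑<-mono {suc d} B≤C =
  +-mono-≤ (∑-mono λ j → B≤C zero (suc j) λ ())
           (∑<-mono λ i j i≢j → B≤C (suc i) (suc j) (i≢j ∘ Fin-suc-injective))

∑∑≡diagonal+∑< : ∀ {d} (A : Fin d → Fin d → ℕ) →
  ∑ (λ i → ∑ (A i)) ≡ ∑ (λ i → A i i) + ∑< (λ i j → A i j + A j i)
∑∑≡diagonal+∑< {zero}  A = refl
∑∑≡diagonal+∑< {suc d} A = begin
    (A zero zero + X) + ∑ (λ i → A (suc i) zero + ∑ (A (suc i) ∘ suc))
  ≡⟨ cong ((A zero zero + X) +_) (∑-distrib-+ (λ i → A (suc i) zero) (λ i → ∑ (A (suc i) ∘ suc))) ⟩
    (A zero zero + X) + (Y + ∑ (λ i → ∑ (A (suc i) ∘ suc)))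
  ≡⟨ cong (λ s → (A zero zero + X) + (Y + s)) (∑∑≡diagonal+∑< (λ i j → A (suc i) (suc j))) ⟩
    (A zero zero + X) + (Y + (Z + W))
  ≡⟨ solve 5 (λ a x y z w → (a :+ x) :+ (y :+ (z :+ w)) := (a :+ z) :+ ((x :+ y) :+ w)) refl
       (A zero zero) X Y Z W ⟩
    (A zero zero + Z) + ((X + Y) + W)
  ≡⟨ cong (λ s → (A zero zero + Z) + (s + W)) (sym (∑-distrib-+ (A zero ∘ suc) (λ j → A (suc j) zero))) ⟩
    (A zero zero + Z) + (∑ (λ j → A zero (suc j) + A (suc j) zero) + W)
  ∎
  where
  open ≡-Reasoning
  X Y Z W : ℕ
  X = ∑ (A zero ∘ suc)
  Y = ∑ (λ i → A (suc i) zero)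
  Z = ∑ (λ i → A (suc i) (suc i))
  W = ∑< (λ i j → A (suc i) (suc j) + A (suc j) (suc i))

∑-lookup : ∀ {A : Set} (h : A → ℕ) (xs : List A) → ∑ (h ∘ lookup xs) ≡ sum (map h xs)
∑-lookup h []       = refl
∑-lookup h (x ∷ xs) = cong (h x +_) (∑-lookup h xs)

sum-map-∘ : ∀ {A B : Set} (h : B → ℕ) (g : A → B) xs → sum (map h (map g xs)) ≡ sum (map (h ∘ g) xs)
sum-map-∘ h g xs = cong sum (sym (map-∘ xs))

sum-map-++ : ∀ {A : Set} (h : A → ℕ) xs ys → sum (map h (xs ++ ys)) ≡ sum (map h xs) + sum (map h ys)
sum-map-++ h xs ys = trans (cong sum (map-++ h xs ys)) (sum-++ (map h xs) (map h ys))

sum-map-+ : ∀ {A : Set} (g h : A → ℕ) xs → sum (map (λ x → g x + h x) xs) ≡ sum (map g xs) + sum (map h xs)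
sum-map-+ g h []       = refl
sum-map-+ g h (x ∷ xs) rewrite sum-map-+ g h xs = +-interchange (g x) (h x) (sum (map g xs)) (sum (map h xs))

indicator : ∀ {P : Set} → Dec P → ℕ
indicator (yes _) = 1
indicator (no _)  = 0

indicator≤1 : ∀ {P : Set} (p? : Dec P) → indicator p? ≤ 1
indicator≤1 (yes _) = s≤s z≤n
indicator≤1 (no _)  = z≤n

indicator-yes : ∀ {P : Set} → P → (p? : Dec P) → indicator p? ≡ 1
indicator-yes p (yes _) = refl
indicator-yes p (no ¬p) = ⊥-elim (¬p p)

indicator-no : ∀ {P : Set} → ¬ P → (p? : Dec P) → indicator p? ≡ 0
indicator-no ¬p (yes p) = ⊥-elim (¬p p)
indicator-no ¬p (no _)  = refl

sum-map-mono : ∀ {A : Set} {g h : A → ℕ} xs → (∀ x → x ∈ xs → g x ≤ h x) → sum (map g xs) ≤ sum (map h xs)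
sum-map-mono []       g≤h = z≤n
sum-map-mono (x ∷ xs) g≤h = +-mono-≤ (g≤h x (here refl)) (sum-map-mono xs λ y y∈ → g≤h y (there y∈))

sum-map-< : ∀ {A : Set} {g h : A → ℕ} {x} xs → (∀ y → g y ≤ h y) → x ∈ xs → g x < h x →
            sum (map g xs) < sum (map h xs)
sum-map-< (y ∷ xs) g≤h (here refl) gx<hx = +-mono-<-≤ gx<hx (sum-map-mono xs λ z _ → g≤h z)
sum-map-< (y ∷ xs) g≤h (there x∈)  gx<hx = +-mono-≤-< (g≤h y) (sum-map-< xs g≤h x∈ gx<hx)

count : ∀ {A : Set} {P : A → Set} → (∀ x → Dec (P x)) → List A → ℕ
count P? xs = sum (map (λ x → indicator (P? x)) xs)

module _ {A : Set} {P : A → Set} (P? : ∀ x → Dec (P x)) where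

  count-≤ : ∀ xs → count P? xs ≤ length xs
  count-≤ []       = z≤n
  count-≤ (x ∷ xs) = +-mono-≤ (indicator≤1 (P? x)) (count-≤ xs)

  count-< : ∀ {x} xs → x ∈ xs → ¬ P x → count P? xs < length xs
  count-< (y ∷ xs) (here refl) ¬py rewrite indicator-no ¬py (P? y) = s≤s (count-≤ xs)
  count-< (y ∷ xs) (there x∈)  ¬px = +-mono-≤-< (indicator≤1 (P? y)) (count-< xs x∈ ¬px)

  count-none : ∀ xs → (∀ x → ¬ P x) → count P? xs ≡ 0
  count-none []       none = refl
  count-none (x ∷ xs) none rewrite indicator-no (none x) (P? x) = count-none xs none

  count-all : ∀ xs → (∀ x → x ∈ xs → P x) → count P? xs ≡ length xs
  count-all []       all = refl
  count-all (x ∷ xs) all rewrite indicator-yes (all x (here refl)) (P? x) =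
    cong suc (count-all xs λ y y∈ → all y (there y∈))

  count-some : ∀ xs → count P? xs ≢ 0 → ∃ P
  count-some []       ≢0 = ⊥-elim (≢0 refl)
  count-some (x ∷ xs) ≢0 with P? x
  ... | yes px = x , px
  ... | no _   = count-some xs ≢0

  unique⇒length≤count : ∀ {ys} xs → Unique ys → (∀ {y} → y ∈ ys → y ∈ xs) → All P ys →
                        length ys ≤ count P? xs
  unique⇒length≤count {[]}     xs _ _ _ = z≤n
  unique⇒length≤count {y ∷ ys} xs (y∉ys ∷ ys!) ys⊆xs (py ∷ pys) with ∈-∃++ (ys⊆xs (here refl))
  ... | xs₁ , xs₂ , refl = begin
      suc (length ys)
    ≤⟨ s≤s (unique⇒length≤count (xs₁ ++ xs₂) ys!
             (λ y′∈ → remove xs₁ (ys⊆xs (there y′∈)) (All.lookup y∉ys y′∈)) pys) ⟩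
      suc (count P? (xs₁ ++ xs₂))
    ≡⟨ cong suc (sum-map-++ (λ x → indicator (P? x)) xs₁ xs₂) ⟩
      suc (count P? xs₁ + count P? xs₂)
    ≡⟨ sym (+-suc _ _) ⟩
      count P? xs₁ + (1 + count P? xs₂)
    ≡⟨ cong (λ k → count P? xs₁ + (k + count P? xs₂)) (sym (indicator-yes py (P? y))) ⟩
      count P? xs₁ + (indicator (P? y) + count P? xs₂)
    ≡⟨ sym (sum-map-++ (λ x → indicator (P? x)) xs₁ (y ∷ xs₂)) ⟩
      count P? (xs₁ ++ y ∷ xs₂)
    ∎
    where
    open ≤-Reasoning
    remove : ∀ xs₁ {x xs₂} → x ∈ xs₁ ++ y ∷ xs₂ → y ≢ x → x ∈ xs₁ ++ xs₂
    remove []        (here refl) y≢x = ⊥-elim (y≢x refl)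
    remove []        (there x∈)  _   = x∈
    remove (_ ∷ xs₁) (here refl) _   = here refl
    remove (_ ∷ xs₁) (there x∈)  y≢x = there (remove xs₁ x∈ y≢x)

count-cong : ∀ {A : Set} {P Q : A → Set} (P? : ∀ x → Dec (P x)) (Q? : ∀ x → Dec (Q x)) xs →
             (∀ x → P x → Q x) → (∀ x → Q x → P x) → count P? xs ≡ count Q? xs
count-cong P? Q? xs P⇒Q Q⇒P = cong sum (map-cong (λ x → same (P? x) (Q? x) (P⇒Q x) (Q⇒P x)) xs)
  where
  same : ∀ {P Q : Set} (p? : Dec P) (q? : Dec Q) → (P → Q) → (Q → P) → indicator p? ≡ indicator q?
  same (yes _) (yes _) _   _   = refl
  same (no _)  (no _)  _   _   = refl
  same (yes p) (no ¬q) p⇒q _   = ⊥-elim (¬q (p⇒q p))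
  same (no ¬p) (yes q) _   q⇒p = ⊥-elim (¬p (q⇒p q))

countBetween : ∀ {A : Set} → (A → ℕ) → ℕ → ℕ → List A → ℕ
countBetween f a c = count (λ w → between? a (f w) c)

countBetween-sym : ∀ {A : Set} (f : A → ℕ) a c xs → countBetween f a c xs ≡ countBetween f c a xs
countBetween-sym f a c xs = count-cong _ _ xs (λ _ → Between-sym) (λ _ → Between-sym)

-- Σ_i n_i + Σ_{i<j} max(n_i, n_j): the largest possible total cost of the
-- edges at the root, for immediate subtrees of sizes n_i.
rootCost : List ℕ → ℕ
rootCost []       = 0
rootCost (x ∷ xs) = x + sum (map (x ⊔_) xs) + rootCost xs

rootCost-lookup : ∀ {A : Set} (h : A → ℕ) (xs : List A) →
  ∑ (h ∘ lookup xs) + ∑< (λ i j → h (lookup xs i) ⊔ h (lookup xs j)) ≡ rootCost (map h xs)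
rootCost-lookup h []       = refl
rootCost-lookup h (x ∷ xs) = begin
    (h x + ∑ n) + (∑ (λ j → h x ⊔ n j) + ∑< (λ i j → n i ⊔ n j))
  ≡⟨ +-interchange (h x) (∑ n) (∑ (λ j → h x ⊔ n j)) (∑< (λ i j → n i ⊔ n j)) ⟩
    (h x + ∑ (λ j → h x ⊔ n j)) + (∑ n + ∑< (λ i j → n i ⊔ n j))
  ≡⟨ cong₂ (λ u v → (h x + u) + v)
       (trans (∑-lookup ((h x ⊔_) ∘ h) xs) (cong sum (map-∘ xs)))
       (rootCost-lookup h xs) ⟩
    rootCost (map h (x ∷ xs))
  ∎
  where
  open ≡-Reasoning
  n : Fin (length xs) → ℕ
  n = h ∘ lookup xs

rootCost-↭ : ∀ {xs ys} → xs ↭ ys → rootCost xs ≡ rootCost ys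
rootCost-↭ Perm.refl          = refl
rootCost-↭ (Perm.prep x p)    = cong₂ (λ u v → x + u + v) (sum-↭ (↭-map⁺ (x ⊔_) p)) (rootCost-↭ p)
rootCost-↭ {x ∷ y ∷ _} {_ ∷ _ ∷ ys} (Perm.swap x y p)
  rewrite sum-↭ (↭-map⁺ (x ⊔_) p) | sum-↭ (↭-map⁺ (y ⊔_) p) | rootCost-↭ p | ⊔-comm x y =
  solve 6 (λ x y m a b q → x :+ (m :+ a) :+ (y :+ b :+ q) := y :+ (m :+ b) :+ (x :+ a :+ q)) refl
    x y (y ⊔ x) (sum (map (x ⊔_) ys)) (sum (map (y ⊔_) ys)) (rootCost ys)
rootCost-↭ (Perm.trans p q)   = trans (rootCost-↭ p) (rootCost-↭ q)

private
  sum-map-⊔-dominated : ∀ x xs → All (_≤ x) xs → sum (map (x ⊔_) xs) ≡ length xs * x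
  sum-map-⊔-dominated x []       []         = refl
  sum-map-⊔-dominated x (y ∷ xs) (y≤x ∷ ys) rewrite m≥n⇒m⊔n≡m y≤x =
    cong (x +_) (sum-map-⊔-dominated x xs ys)

  sum-map-sum-cons : ∀ x (L : List (List ℕ)) →
    sum (map sum (map (x ∷_) L)) ≡ length L * x + sum (map sum L)
  sum-map-sum-cons x []      = refl
  sum-map-sum-cons x (l ∷ L) rewrite sum-map-sum-cons x L = +-interchange x (sum l) (length L * x) (sum (map sum L))

  length-inits : ∀ (xs : List ℕ) → length (inits xs) ≡ suc (length xs)
  length-inits []       = refl
  length-inits (x ∷ xs) = cong suc (trans (length-map (x ∷_) (inits xs)) (length-inits xs))

  prefixSumsSum-cons : ∀ x xs → prefixSumsSum (x ∷ xs) ≡ suc (length xs) * x + prefixSumsSum xs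
  prefixSumsSum-cons x xs = trans (sum-map-sum-cons x (inits xs))
    (cong (λ k → k * x + prefixSumsSum xs) (length-inits xs))

prefixSumsSum≡rootCost : ∀ xs → Linked (λ a b → b ≤ a) xs → prefixSumsSum xs ≡ rootCost xs
prefixSumsSum≡rootCost []       _  = refl
prefixSumsSum≡rootCost (x ∷ xs) xs↓ = begin
    prefixSumsSum (x ∷ xs)
  ≡⟨ prefixSumsSum-cons x xs ⟩
    suc (length xs) * x + prefixSumsSum xs
  ≡⟨ cong₂ (λ u v → x + u + v) (sym (sum-map-⊔-dominated x xs (bounded xs xs↓)))
       (prefixSumsSum≡rootCost xs (Linked.tail xs↓)) ⟩
    rootCost (x ∷ xs)
  ∎
  where
  open ≡-Reasoning
  bounded : ∀ ys → Linked (λ a b → b ≤ a) (x ∷ ys) → All (_≤ x) ys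
  bounded []       _       = []
  bounded (y ∷ ys) (y≤x ∷ l) = Linked⇒All (λ b≤a c≤b → ≤-trans c≤b b≤a) y≤x l

rootOf : (t : Tree) → Pos t
rootOf (node _) = root

embed : ∀ {ts} (i : Fin (length ts)) → Pos (lookup ts i) → Any Pos ts
embed {_ ∷ _} zero    v = here v
embed {_ ∷ _} (suc i) v = there (embed i v)

childRoot : ∀ ts (i : Fin (length ts)) → Pos (node ts)
childRoot ts i = sub (embed i (rootOf (lookup ts i)))

liftEdge : ∀ {ts} (i : Fin (length ts)) → Pos (lookup ts i) × Pos (lookup ts i) → Pos (node ts) × Pos (node ts)
liftEdge i e = sub (embed i (proj₁ e)) , sub (embed i (proj₂ e))

data VertexView (ts : List Tree) : Pos (node ts) → Set where
  isRoot  : VertexView ts root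
  inChild : ∀ i w → VertexView ts (sub (embed i w))

vertexView : ∀ {ts} (v : Pos (node ts)) → VertexView ts v
vertexView root    = isRoot
vertexView (sub a) = go a
  where
  go : ∀ {ts} (a : Any Pos ts) → VertexView ts (sub a)
  go (here v)  = inChild zero v
  go (there a) with go a
  ... | inChild i w = inChild (suc i) w

sub-injective : ∀ {ts} {a b : Any Pos ts} → sub a ≡ sub b → a ≡ b
sub-injective refl = refl

embed-injective : ∀ {ts : List Tree} {i : Fin (length ts)} {v w} → embed {ts} i v ≡ embed i w → v ≡ w
embed-injective {_ ∷ _}  {zero}  eq = here-injective eq
embed-injective {t ∷ ts} {suc i} eq = embed-injective {ts} {i} (there-injective {x = t} eq)

embed-index-injective : ∀ {ts : List Tree} {i j : Fin (length ts)} {v w} → embed {ts} i v ≡ embed j w → i ≡ j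
embed-index-injective {_ ∷ _}  {zero}  {zero}  _  = refl
embed-index-injective {t ∷ ts} {suc i} {suc j} eq = cong suc (embed-index-injective {ts} {i} {j} (there-injective {x = t} eq))
embed-index-injective {_ ∷ _}  {zero}  {suc j} ()
embed-index-injective {_ ∷ _}  {suc i} {zero}  ()

tree-ind : ∀ {ℓ} (P : Tree → Set ℓ) → (∀ ts → (∀ i → P (lookup ts i)) → P (node ts)) → ∀ t → P t
tree-ind P step (node ts) = step ts (children ts)
  where
  children : ∀ ts i → P (lookup ts i)
  children (t ∷ ts) zero    = tree-ind P step t
  children (t ∷ ts) (suc i) = children ts i

mutual
  vertices : (t : Tree) → List (Pos t)
  vertices (node ts) = root ∷ map sub (forestVertices ts)

  forestVertices : (ts : List Tree) → List (Any Pos ts)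
  forestVertices []       = []
  forestVertices (t ∷ ts) = map here (vertices t) ++ map there (forestVertices ts)

mutual
  length-vertices : ∀ t → length (vertices t) ≡ size t
  length-vertices (node ts) = cong suc (trans (length-map sub (forestVertices ts)) (length-forestVertices ts))

  length-forestVertices : ∀ ts → length (forestVertices ts) ≡ sizes ts
  length-forestVertices []       = refl
  length-forestVertices (t ∷ ts) = trans (length-++ (map inHead (vertices t)))
    (cong₂ _+_ (trans (length-map inHead (vertices t)) (length-vertices t))
               (trans (length-map inTail (forestVertices ts)) (length-forestVertices ts)))
    where
    inHead : Pos t → Any Pos (t ∷ ts)
    inHead = here
    inTail : Any Pos ts → Any Pos (t ∷ ts)
    inTail = there

mutual
  ∈-vertices : ∀ {t} (v : Pos t) → v ∈ vertices t
  ∈-vertices root    = here refl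
  ∈-vertices (sub a) = there (∈-map⁺ sub (∈-forestVertices a))

  ∈-forestVertices : ∀ {ts} (a : Any Pos ts) → a ∈ forestVertices ts
  ∈-forestVertices (here v)  = ∈-++⁺ˡ (∈-map⁺ here (∈-vertices v))
  ∈-forestVertices {t ∷ _} (there a) = ∈-++⁺ʳ (map here (vertices t)) (∈-map⁺ there (∈-forestVertices a))

mutual
  vertices-unique : ∀ t → Unique (vertices t)
  vertices-unique (node ts) = All.tabulate root∉ ∷ Unique-map⁺ sub-injective (forestVertices-unique ts)
    where
    root∉ : ∀ {v} → v ∈ map sub (forestVertices ts) → root ≢ v
    root∉ v∈ refl with ∈-map⁻ sub v∈
    ... | _ , _ , ()

  forestVertices-unique : ∀ ts → Unique (forestVertices ts)
  forestVertices-unique []       = []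
  forestVertices-unique (t ∷ ts) =
    Unique-++⁺ (Unique-map⁺ here-injective (vertices-unique t))
               (Unique-map⁺ there-injective (forestVertices-unique ts)) disjoint
    where
    disjoint : Disjoint (map here (vertices t)) (map there (forestVertices ts))
    disjoint (a∈₁ , a∈₂) with ∈-map⁻ here a∈₁ | ∈-map⁻ there a∈₂
    ... | _ , _ , refl | _ , _ , ()

sum-vertices : ∀ ts (h : Pos (node ts) → ℕ) →
  sum (map h (vertices (node ts))) ≡ h root + ∑ (λ i → sum (map (h ∘ sub ∘ embed i) (vertices (lookup ts i))))
sum-vertices ts h = cong (h root +_) (trans (sum-map-∘ h sub (forestVertices ts)) (forest ts (h ∘ sub)))
  where
  forest : ∀ ts (h : Any Pos ts → ℕ) →
    sum (map h (forestVertices ts)) ≡ ∑ (λ i → sum (map (h ∘ embed i) (vertices (lookup ts i))))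
  forest []       h = refl
  forest (t ∷ ts) h = trans (sum-map-++ h (map here (vertices t)) (map there (forestVertices ts)))
    (cong₂ _+_ (sum-map-∘ h here (vertices t))
               (trans (sum-map-∘ h there (forestVertices ts)) (forest ts (h ∘ there))))

sum-edges : ∀ ts (h : Pos (node ts) × Pos (node ts) → ℕ) →
  sum (map h (edges (node ts))) ≡
  ∑ (λ i → h (root , childRoot ts i)) + ∑ (λ i → sum (map (h ∘ liftEdge i) (edges (lookup ts i))))
sum-edges ts h = trans (sum-map-++ h (map rootEdge (childRoots ts)) (map subEdge (edgesF ts)))
  (cong₂ _+_ (trans (sum-map-∘ h rootEdge (childRoots ts)) (atRoot ts (h ∘ rootEdge)))
             (trans (sum-map-∘ h subEdge (edgesF ts)) (inForest ts (h ∘ subEdge))))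
  where
  rootEdge : Any Pos ts → Pos (node ts) × Pos (node ts)
  rootEdge c = root , sub c
  subEdge : Any Pos ts × Any Pos ts → Pos (node ts) × Pos (node ts)
  subEdge e = sub (proj₁ e) , sub (proj₂ e)
  atRoot : ∀ ts (h : Any Pos ts → ℕ) →
    sum (map h (childRoots ts)) ≡ ∑ (λ i → h (embed i (rootOf (lookup ts i))))
  atRoot []             h = refl
  atRoot (node _ ∷ ts) h =
    cong (h (here root) +_) (trans (sum-map-∘ h there (childRoots ts)) (atRoot ts (h ∘ there)))
  inForest : ∀ ts (h : Any Pos ts × Any Pos ts → ℕ) →
    sum (map h (edgesF ts)) ≡
    ∑ (λ i → sum (map (λ e → h (embed i (proj₁ e) , embed i (proj₂ e))) (edges (lookup ts i))))
  inForest []       h = refl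
  inForest (t ∷ ts) h = trans (sum-map-++ h (map _ (edges t)) (map _ (edgesF ts)))
    (cong₂ _+_ (sum-map-∘ h _ (edges t))
               (trans (sum-map-∘ h _ (edgesF ts)) (inForest ts (λ e → h (there (proj₁ e) , there (proj₂ e))))))

rootEdge∈edges : ∀ ts i → (root , childRoot ts i) ∈ edges (node ts)
rootEdge∈edges ts i = ∈-++⁺ˡ (∈-map⁺ (λ c → root , sub c) (∈-childRoots ts i))
  where
  ∈-childRoots : ∀ ts i → embed i (rootOf (lookup ts i)) ∈ childRoots ts
  ∈-childRoots (node _ ∷ ts) zero    = here refl
  ∈-childRoots (node _ ∷ ts) (suc i) = there (∈-map⁺ there (∈-childRoots ts i))

liftEdge∈edges : ∀ ts i {e} → e ∈ edges (lookup ts i) → liftEdge i e ∈ edges (node ts)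
liftEdge∈edges ts i e∈ = ∈-++⁺ʳ (map _ (childRoots ts)) (∈-map⁺ _ (∈-edgesF ts i e∈))
  where
  ∈-edgesF : ∀ ts i {e} → e ∈ edges (lookup ts i) → (embed i (proj₁ e) , embed i (proj₂ e)) ∈ edgesF ts
  ∈-edgesF (t ∷ ts) zero    e∈ = ∈-++⁺ˡ (∈-map⁺ _ e∈)
  ∈-edgesF (t ∷ ts) (suc i) e∈ = ∈-++⁺ʳ (map _ (edges t)) (∈-map⁺ _ (∈-edgesF ts i e∈))

private
  childRootView : ∀ ts {c} → c ∈ childRoots ts → ∃ λ i → c ≡ embed i (rootOf (lookup ts i))
  childRootView (node _ ∷ ts) (here refl) = zero , refl
  childRootView (node _ ∷ ts) (there c∈) with ∈-map⁻ there c∈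
  ... | _ , c∈′ , refl with childRootView ts c∈′
  ...   | i , refl = suc i , refl

  forestEdgeView : ∀ ts {e} → e ∈ edgesF ts →
    ∃ λ i → ∃ λ e′ → e′ ∈ edges (lookup ts i) × e ≡ (embed i (proj₁ e′) , embed i (proj₂ e′))
  forestEdgeView (t ∷ ts) e∈ with ∈-++⁻ (map _ (edges t)) e∈
  ... | inj₁ e∈₁ with ∈-map⁻ _ e∈₁
  ...   | e′ , e′∈ , refl = zero , e′ , e′∈ , refl
  forestEdgeView (t ∷ ts) e∈ | inj₂ e∈₂ with ∈-map⁻ _ e∈₂
  ...   | _ , e∈′ , refl with forestEdgeView ts e∈′
  ...     | i , e′ , e′∈ , refl = suc i , e′ , e′∈ , refl

data EdgeView (ts : List Tree) : Pos (node ts) × Pos (node ts) → Set where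
  rootEdge : ∀ i → EdgeView ts (root , childRoot ts i)
  subEdge  : ∀ i e → e ∈ edges (lookup ts i) → EdgeView ts (liftEdge i e)

edgeView : ∀ ts {e} → e ∈ edges (node ts) → EdgeView ts e
edgeView ts e∈ with ∈-++⁻ (map _ (childRoots ts)) e∈
... | inj₁ e∈₁ with ∈-map⁻ _ e∈₁
...   | _ , c∈ , refl with childRootView ts c∈
...     | i , refl = rootEdge i
edgeView ts e∈ | inj₂ e∈₂ with ∈-map⁻ _ e∈₂
...   | _ , e∈′ , refl with forestEdgeView ts e∈′
...     | i , e′ , e′∈ , refl = subEdge i e′ e′∈

edges-irreflexive : ∀ t {e} → e ∈ edges t → proj₁ e ≢ proj₂ e
edges-irreflexive = tree-ind (λ t → ∀ {e} → e ∈ edges t → proj₁ e ≢ proj₂ e) step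
  where
  step : ∀ ts → (∀ i {e} → e ∈ edges (lookup ts i) → proj₁ e ≢ proj₂ e) →
         ∀ {e} → e ∈ edges (node ts) → proj₁ e ≢ proj₂ e
  step ts ih e∈ with edgeView ts e∈
  ... | rootEdge i        = λ ()
  ... | subEdge i e′ e′∈  = ih i e′∈ ∘ embed-injective ∘ sub-injective

-- Labellings

-- A labelling of the vertices of t by natural numbers stands for the
-- arrangement listing the vertices by increasing label; an edge then has
-- length one more than the number of vertices labelled strictly between its
-- endpoints.
labelDist : ∀ {t} → (Pos t → ℕ) → Pos t → Pos t → ℕ
labelDist {t} f u v = suc (countBetween f (f u) (f v) (vertices t))

labelCost : ∀ {t} → (Pos t → ℕ) → ℕ
labelCost {t} f = sum (map (λ e → labelDist f (proj₁ e) (proj₂ e)) (edges t))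

LabelPlanar : ∀ {t} → (Pos t → ℕ) → Set
LabelPlanar {t} f = ∀ e e′ → e ∈ edges t → e′ ∈ edges t →
  ¬ Separates (f (proj₁ e)) (f (proj₂ e)) (f (proj₁ e′)) (f (proj₂ e′))

LabelProjective : ∀ {t} → (Pos t → ℕ) → Set
LabelProjective {t} f = LabelPlanar f × (∀ e → e ∈ edges t → ¬ Between (f (proj₁ e)) (f (rootOf t)) (f (proj₂ e)))

mutual
  Dmax : Tree → ℕ
  Dmax (node ts) = DmaxF ts + rootCost (map size ts)

  DmaxF : List Tree → ℕ
  DmaxF []       = 0
  DmaxF (t ∷ ts) = Dmax t + DmaxF ts

DmaxF-sum : ∀ ts → DmaxF ts ≡ sum (map Dmax ts)
DmaxF-sum []       = refl
DmaxF-sum (t ∷ ts) = cong (Dmax t +_) (DmaxF-sum ts)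

DmaxF-∑ : ∀ ts → DmaxF ts ≡ ∑ (Dmax ∘ lookup ts)
DmaxF-∑ ts = trans (DmaxF-sum ts) (sym (∑-lookup Dmax ts))

restrict : ∀ {ts} → (Pos (node ts) → ℕ) → (i : Fin (length ts)) → Pos (lookup ts i) → ℕ
restrict f i = f ∘ sub ∘ embed i

-- The upper bound

SomeEdgeSpans : ∀ {s} → (Pos s → ℕ) → ℕ → Set
SomeEdgeSpans {s} g p = ∃ λ e → e ∈ edges s × Between (g (proj₁ e)) p (g (proj₂ e))

private
  RootPathSpans : Tree → Set
  RootPathSpans s = ∀ (g : Pos s → ℕ) p → (∀ z → g z ≢ p) →
    ∀ u → Between (g u) p (g (rootOf s)) → SomeEdgeSpans g p

  Leaves : ∀ {s} → (Pos s → ℕ) → (ℕ → Set) → Pos s × Pos s → Set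
  Leaves g In e = (In (g (proj₁ e)) × ¬ In (g (proj₂ e))) ⊎ (¬ In (g (proj₁ e)) × In (g (proj₂ e)))

  HasBoundaryEdges : Tree → Set₁
  HasBoundaryEdges s = ∀ (g : Pos s → ℕ) (In : ℕ → Set) → (∀ n → Dec (In n)) →
    ∀ z → In (g z) → ¬ In (g (rootOf s)) → ∃ λ e → e ∈ edges s × Leaves g In e

-- The path from u to the root of s passes every unused label between g u and g root.
spanning-edge-to-root : ∀ s (g : Pos s → ℕ) p → (∀ z → g z ≢ p) →
  ∀ u → Between (g u) p (g (rootOf s)) → SomeEdgeSpans g p
spanning-edge-to-root = tree-ind RootPathSpans step
  where
  step : ∀ ts → (∀ i → RootPathSpans (lookup ts i)) → RootPathSpans (node ts)
  step ts ih g p p∉ u btw with vertexView u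
  ... | isRoot      = ⊥-elim (Between-irrefl btw)
  ... | inChild i w with Between-split (g (childRoot ts i)) btw (p∉ (childRoot ts i))
  ...   | inj₁ below with ih i (restrict g i) p (p∉ ∘ sub ∘ embed i) w below
  ...     | e , e∈ , spans = liftEdge i e , liftEdge∈edges ts i e∈ , spans
  step ts ih g p p∉ u btw | inChild i w | inj₂ above =
    (root , childRoot ts i) , rootEdge∈edges ts i , Between-sym above

spanning-edge : ∀ s (g : Pos s → ℕ) p → (∀ z → g z ≢ p) →
  ∀ u v → Between (g u) p (g v) → SomeEdgeSpans g p
spanning-edge s g p p∉ u v btw with Between-split (g (rootOf s)) btw (p∉ (rootOf s))
... | inj₁ btw₁ = spanning-edge-to-root s g p p∉ u btw₁
... | inj₂ btw₂ = spanning-edge-to-root s g p p∉ v (Between-sym btw₂)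

boundary-edge : ∀ s (g : Pos s → ℕ) (In : ℕ → Set) → (∀ n → Dec (In n)) →
  ∀ z → In (g z) → ¬ In (g (rootOf s)) → ∃ λ e → e ∈ edges s × Leaves g In e
boundary-edge = tree-ind HasBoundaryEdges step
  where
  step : ∀ ts → (∀ i → HasBoundaryEdges (lookup ts i)) → HasBoundaryEdges (node ts)
  step ts ih g In In? z z∈ root∉ with vertexView z
  ... | isRoot      = ⊥-elim (root∉ z∈)
  ... | inChild i w with In? (g (childRoot ts i))
  ...   | yes cr∈ = (root , childRoot ts i) , rootEdge∈edges ts i , inj₂ (root∉ , cr∈)
  ...   | no cr∉ with ih i (restrict g i) In In? w z∈ cr∉
  ...     | e , e∈ , leaves = liftEdge i e , liftEdge∈edges ts i e∈ , leaves

countBetween-root<size : ∀ t (g : Pos t → ℕ) r → countBetween g r (g (rootOf t)) (vertices t) < size t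
countBetween-root<size t g r = subst (countBetween g r (g (rootOf t)) (vertices t) <_) (length-vertices t)
  (count-< _ (vertices t) (∈-vertices (rootOf t)) λ btw → Between⇒≢ʳ btw refl)

module ProjectiveLabelling (ts : List Tree) (f : Pos (node ts) → ℕ)
                           (f-inj : Injective _≡_ _≡_ f) (f-proj : LabelProjective f) where

  sub≢root : ∀ {a} → f (sub a) ≢ f root
  sub≢root eq with f-inj eq
  ... | ()

  child≢child : ∀ {i j u w} → i ≢ j → f (sub (embed i u)) ≢ f (sub (embed j w))
  child≢child i≢j eq = i≢j (embed-index-injective (sub-injective (f-inj eq)))

  root∉child : ∀ i u v → ¬ Between (restrict f i u) (f root) (restrict f i v)
  root∉child i u v btw with spanning-edge (lookup ts i) (restrict f i) (f root) (λ _ → sub≢root) u v btw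
  ... | e , e∈ , spans = proj₂ f-proj (liftEdge i e) (liftEdge∈edges ts i e∈) spans

  -- An edge of child i spanning a label of child j would separate child j
  -- either from its own root edge or from the root.
  child∉child : ∀ i j → i ≢ j → ∀ u v w → ¬ Between (restrict f i u) (restrict f j w) (restrict f i v)
  child∉child i j i≢j u v w btw
    with spanning-edge (lookup ts i) (restrict f i) (restrict f j w) (λ _ → child≢child i≢j) u v btw
  ... | (x , y) , xy∈ , w-in = absurd
    where
    E : Pos (node ts) × Pos (node ts)
    E = liftEdge i (x , y)
    E∈ : E ∈ edges (node ts)
    E∈ = liftEdge∈edges ts i xy∈
    Inside : ℕ → Set
    Inside n = Between (restrict f i x) n (restrict f i y)
    outside : ∀ {a} → ¬ Inside (restrict f j a) → Outside (restrict f i x) (restrict f i y) (restrict f j a)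
    outside a∉ = ¬Between⇒Outside w-in a∉ (child≢child (i≢j ∘ sym)) (child≢child (i≢j ∘ sym))
    absurd : ⊥
    absurd with between? (restrict f i x) (f (childRoot ts j)) (restrict f i y)
    ... | yes cr-in = proj₁ f-proj E (root , childRoot ts j) E∈ (rootEdge∈edges ts j)
        (inj₂ (cr-in , ¬Between⇒Outside w-in (proj₂ f-proj E E∈) (sub≢root ∘ sym) (sub≢root ∘ sym)))
    ... | no cr-out with boundary-edge (lookup ts j) (restrict f j) Inside
                           (λ n → between? (restrict f i x) n (restrict f i y)) w w-in cr-out
    ...   | e′ , e′∈ , inj₁ (in₁ , out₂) =
              proj₁ f-proj E (liftEdge j e′) E∈ (liftEdge∈edges ts j e′∈) (inj₁ (in₁ , outside out₂))
    ...   | e′ , e′∈ , inj₂ (out₁ , in₂) =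
              proj₁ f-proj E (liftEdge j e′) E∈ (liftEdge∈edges ts j e′∈) (inj₂ (in₂ , outside out₁))

  labelDist-restrict : ∀ i u v → labelDist f (sub (embed i u)) (sub (embed i v)) ≡ labelDist (restrict f i) u v
  labelDist-restrict i u v = cong suc (begin
      countBetween f fu fv (vertices (node ts))
    ≡⟨ sum-vertices ts (λ w → indicator (between? fu (f w) fv)) ⟩
      indicator (between? fu (f root) fv) + ∑ inside
    ≡⟨ cong (_+ ∑ inside) (indicator-no (root∉child i u v) (between? fu (f root) fv)) ⟩
      ∑ inside
    ≡⟨ ∑-single inside i (λ j j≢i → count-none _ (vertices (lookup ts j)) (child∉child i j (j≢i ∘ sym) u v)) ⟩
      countBetween (restrict f i) fu fv (vertices (lookup ts i))
    ∎)
    where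
    open ≡-Reasoning
    fu fv : ℕ
    fu = restrict f i u
    fv = restrict f i v
    inside : Fin (length ts) → ℕ
    inside j = countBetween (restrict f j) fu fv (vertices (lookup ts j))

  restrict-injective : ∀ i → Injective _≡_ _≡_ (restrict f i)
  restrict-injective i = embed-injective ∘ sub-injective ∘ f-inj

  restrict-projective : ∀ i → LabelProjective (restrict f i)
  restrict-projective i =
    (λ e e′ e∈ e′∈ → proj₁ f-proj (liftEdge i e) (liftEdge i e′)
                                  (liftEdge∈edges ts i e∈) (liftEdge∈edges ts i e′∈)) ,
    λ e e∈ btw → proj₁ f-proj (liftEdge i e) (root , childRoot ts i) (liftEdge∈edges ts i e∈) (rootEdge∈edges ts i)
      (inj₂ (btw , ¬Between⇒Outside btw (proj₂ f-proj (liftEdge i e) (liftEdge∈edges ts i e∈))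
                                        (sub≢root ∘ sym) (sub≢root ∘ sym)))

  labelCost-split : labelCost f ≡ ∑ (λ i → labelDist f root (childRoot ts i)) + ∑ (λ i → labelCost (restrict f i))
  labelCost-split = trans (sum-edges ts (λ e → labelDist f (proj₁ e) (proj₂ e)))
    (cong (∑ (λ i → labelDist f root (childRoot ts i)) +_) (∑-cong λ i →
      cong sum (map-cong (λ e → labelDist-restrict i (proj₁ e) (proj₂ e)) (edges (lookup ts i)))))

  covered : Fin (length ts) → Fin (length ts) → ℕ
  covered i j = countBetween (restrict f j) (f root) (f (childRoot ts i)) (vertices (lookup ts j))

  labelDist-root : ∀ i → labelDist f root (childRoot ts i) ≡ suc (∑ (covered i))
  labelDist-root i = cong suc (trans (sum-vertices ts between-root-cᵢ)
    (cong (_+ ∑ (covered i))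
          (indicator-no (λ btw → Between⇒≢ˡ btw refl) (between? (f root) (f root) (f (childRoot ts i))))))
    where
    between-root-cᵢ : Pos (node ts) → ℕ
    between-root-cᵢ w = indicator (between? (f root) (f w) (f (childRoot ts i)))

  covered-≤ : ∀ i j → covered i j ≤ size (lookup ts j)
  covered-≤ i j = subst (covered i j ≤_) (length-vertices (lookup ts j))
    (count-≤ _ (vertices (lookup ts j)))

  -- Two root edges cannot each cover a vertex of the other's subtree: each
  -- child root would then lie strictly between the root and the other.
  covered-exclusive : ∀ i j → i ≢ j → covered i j ≡ 0 ⊎ covered j i ≡ 0
  covered-exclusive i j i≢j with covered i j ≟ 0 | covered j i ≟ 0
  ... | yes ≡0 | _      = inj₁ ≡0
  ... | no _   | yes ≡0 = inj₂ ≡0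
  ... | no ≢0  | no ≢0′
    with count-some (λ w → between? (f root) (restrict f j w) (f (childRoot ts i))) (vertices (lookup ts j)) ≢0
       | count-some (λ w → between? (f root) (restrict f i w) (f (childRoot ts j))) (vertices (lookup ts i)) ≢0′
  ...   | w , w-under-i | w′ , w′-under-j = ⊥-elim (Between-asym cj-under-ci ci-under-cj)
    where
    cj-under-ci : Between (f root) (f (childRoot ts j)) (f (childRoot ts i))
    cj-under-ci = Between-confined w-under-i (root∉child j w (rootOf (lookup ts j)))
      (child∉child j i (i≢j ∘ sym) w (rootOf (lookup ts j)) (rootOf (lookup ts i)))
      sub≢root (child≢child (i≢j ∘ sym))
    ci-under-cj : Between (f root) (f (childRoot ts i)) (f (childRoot ts j))
    ci-under-cj = Between-confined w′-under-j (root∉child i w′ (rootOf (lookup ts i)))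
      (child∉child i j i≢j w′ (rootOf (lookup ts i)) (rootOf (lookup ts j))) sub≢root (child≢child i≢j)

  covered-pair-≤ : ∀ i j → i ≢ j → covered i j + covered j i ≤ size (lookup ts i) ⊔ size (lookup ts j)
  covered-pair-≤ i j i≢j with covered-exclusive i j i≢j
  ... | inj₁ ≡0 rewrite ≡0 = ≤-trans (covered-≤ j i) (m≤m⊔n _ _)
  ... | inj₂ ≡0 rewrite ≡0 | +-identityʳ (covered i j) = ≤-trans (covered-≤ i j) (m≤n⊔m _ _)

  rootEdges-decomposition : ∑ (λ i → labelDist f root (childRoot ts i)) ≡
                            ∑ (λ i → 1 + covered i i) + ∑< (λ i j → covered i j + covered j i)
  rootEdges-decomposition = begin
      ∑ (λ i → labelDist f root (childRoot ts i))
    ≡⟨ ∑-cong labelDist-root ⟩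
      ∑ (λ i → 1 + ∑ (covered i))
    ≡⟨ ∑-distrib-+ one (λ i → ∑ (covered i)) ⟩
      ∑ one + ∑ (λ i → ∑ (covered i))
    ≡⟨ cong (∑ one +_) (∑∑≡diagonal+∑< covered) ⟩
      ∑ one + (∑ (λ i → covered i i) + ∑< (λ i j → covered i j + covered j i))
    ≡⟨ sym (+-assoc (∑ one) _ _) ⟩
      (∑ one + ∑ (λ i → covered i i)) + ∑< (λ i j → covered i j + covered j i)
    ≡⟨ cong (_+ ∑< (λ i j → covered i j + covered j i)) (sym (∑-distrib-+ one (λ i → covered i i))) ⟩
      ∑ (λ i → 1 + covered i i) + ∑< (λ i j → covered i j + covered j i)
    ∎
    where
    open ≡-Reasoning
    one : Fin (length ts) → ℕ
    one _ = 1

  rootEdges-≤ : ∑ (λ i → labelDist f root (childRoot ts i)) ≤ rootCost (map size ts)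
  rootEdges-≤ = begin
      ∑ (λ i → labelDist f root (childRoot ts i))
    ≡⟨ rootEdges-decomposition ⟩
      ∑ (λ i → 1 + covered i i) + ∑< (λ i j → covered i j + covered j i)
    ≤⟨ +-mono-≤ (∑-mono λ i → countBetween-root<size (lookup ts i) (restrict f i) (f root))
                (∑<-mono covered-pair-≤) ⟩
      ∑ (size ∘ lookup ts) + ∑< (λ i j → size (lookup ts i) ⊔ size (lookup ts j))
    ≡⟨ rootCost-lookup size ts ⟩
      rootCost (map size ts)
    ∎
    where open ≤-Reasoning

private
  LabelCostBounded : Tree → Set
  LabelCostBounded t = ∀ (f : Pos t → ℕ) → Injective _≡_ _≡_ f → LabelProjective f → labelCost f ≤ Dmax t

labelCost≤Dmax : ∀ t (f : Pos t → ℕ) → Injective _≡_ _≡_ f → LabelProjective f → labelCost f ≤ Dmax t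
labelCost≤Dmax = tree-ind LabelCostBounded step
  where
  step : ∀ ts → (∀ i → LabelCostBounded (lookup ts i)) → LabelCostBounded (node ts)
  step ts ih f f-inj f-proj = begin
      labelCost f
    ≡⟨ labelCost-split ⟩
      ∑ (λ i → labelDist f root (childRoot ts i)) + ∑ (λ i → labelCost (restrict f i))
    ≤⟨ +-mono-≤ rootEdges-≤ (∑-mono λ i → ih i (restrict f i) (restrict-injective i) (restrict-projective i)) ⟩
      rootCost (map size ts) + ∑ (Dmax ∘ lookup ts)
    ≡⟨ +-comm (rootCost (map size ts)) _ ⟩
      ∑ (Dmax ∘ lookup ts) + rootCost (map size ts)
    ≡⟨ cong (_+ rootCost (map size ts)) (sym (DmaxF-∑ ts)) ⟩
      Dmax (node ts)
    ∎
    where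
    open ≤-Reasoning
    open ProjectiveLabelling ts f f-inj f-proj

-- Arrangements and labellings

module _ {t : Tree} (a : Arrangement t) where

  private
    p : Pos t → ℕ
    p = pos a

  pos-injective : Injective _≡_ _≡_ p
  pos-injective = proj₁ (bij a) ∘ toℕ-injective

  pos-surjective : ∀ m → m < size t → ∃ λ v → p v ≡ m
  pos-surjective m m<n with proj₂ (bij a) (fromℕ< m<n)
  ... | v , π≡ = v , trans (cong toℕ (π≡ refl)) (toℕ-fromℕ< m<n)

  -- All the positions c+1, …, d-1 are occupied.
  pos-gap : ∀ c d → d < size t → d ≤ suc (c + countBetween p c d (vertices t))
  pos-gap c d d<n with suc c ≤? d
  ... | no 1+c≰d = ≤-trans (≤-pred (≰⇒> 1+c≰d)) (≤-trans (m≤m+n c _) (n≤1+n _))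
  ... | yes 1+c≤d = begin
      d
    ≤⟨ m≤n+m∸n d (suc c) ⟩
      suc c + (d ∸ suc c)
    ≡⟨ cong (suc c +_) (sym (trans (length-map (suc c +_) (upTo (d ∸ suc c))) (length-upTo _))) ⟩
      suc c + length inner
    ≤⟨ +-monoʳ-≤ (suc c)
         (unique⇒length≤count _ (map p (vertices t)) inner-unique inner⊆ (All.tabulate inner-between)) ⟩
      suc c + count (λ m → between? c m d) (map p (vertices t))
    ≡⟨ cong (suc c +_) (sum-map-∘ (λ m → indicator (between? c m d)) p (vertices t)) ⟩
      suc (c + countBetween p c d (vertices t))
    ∎
    where
    open ≤-Reasoning
    inner : List ℕ
    inner = map (suc c +_) (upTo (d ∸ suc c))
    inner-unique : Unique inner
    inner-unique = Unique-map⁺ (+-cancelˡ-≡ (suc c) _ _) (upTo⁺ _)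
    inner-bounds : ∀ {m} → m ∈ inner → c < m × m < d
    inner-bounds m∈ with ∈-map⁻ (suc c +_) m∈
    ... | i , i∈ , refl =
      s≤s (m≤m+n c i) , subst (suc c + i <_) (m+[n∸m]≡n 1+c≤d) (+-monoʳ-< (suc c) (∈-upTo⁻ i∈))
    inner-between : ∀ {m} → m ∈ inner → Between c m d
    inner-between = inj₁ ∘ inner-bounds
    inner⊆ : ∀ {m} → m ∈ inner → m ∈ map p (vertices t)
    inner⊆ {m} m∈ with pos-surjective m (<-trans (proj₂ (inner-bounds m∈)) d<n)
    ... | v , refl = ∈-map⁺ p (∈-vertices v)

  dist≤labelDist : ∀ u v → ∣ p u - p v ∣ ≤ labelDist p u v
  dist≤labelDist u v with ≤-total (p u) (p v)
  ... | inj₁ pu≤pv rewrite m≤n⇒∣m-n∣≡n∸m pu≤pv =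
    m≤n+o⇒m∸n≤o (p v) (p u) (≤-trans (pos-gap (p u) (p v) (toℕ<n (π a v))) (≤-reflexive (sym (+-suc _ _))))
  ... | inj₂ pv≤pu rewrite m≤n⇒∣n-m∣≡n∸m pv≤pu | countBetween-sym p (p u) (p v) (vertices t) =
    m≤n+o⇒m∸n≤o (p u) (p v) (≤-trans (pos-gap (p v) (p u) (toℕ<n (π a u))) (≤-reflexive (sym (+-suc _ _))))

  cost≤labelCost : cost a ≤ labelCost p
  cost≤labelCost = sum-map-mono (edges t) λ e _ → dist≤labelDist (proj₁ e) (proj₂ e)

projective⇒labelProjective : ∀ {ts} (a : Arrangement (node ts)) → Projective a → LabelProjective (pos a)
projective⇒labelProjective a (planar , uncovered) =
  (λ e e′ e∈ e′∈ sep → [ planar e e′ e∈ e′∈ , planar e′ e e′∈ e∈ ] (Separates⇒Crosses _ _ _ _ sep)) ,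
  λ e e∈ btw → uncovered e e∈ (Between⇒⊓<⊔ _ _ _ btw)

module RankArrangement {t : Tree} (f : Pos t → ℕ) (f-inj : Injective _≡_ _≡_ f) where

  rank : Pos t → ℕ
  rank v = count (λ w → f w <? f v) (vertices t)

  rank<size : ∀ v → rank v < size t
  rank<size v = subst (rank v <_) (length-vertices t) (count-< _ (vertices t) (∈-vertices v) (<-irrefl refl))

  private
    indicator-split : ∀ {b c} → b < c → ∀ x → indicator (x <? b) + indicator (between? b x c) ≤ indicator (x <? c)
    indicator-split {b} {c} b<c x with <-cmp x b
    ... | tri< x<b _ _
      rewrite indicator-yes x<b (x <? b)
            | indicator-no (λ { (inj₁ (b<x , _)) → <-asym x<b b<x ; (inj₂ (c<x , _)) → <-asym b<c (<-trans c<x x<b) })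
                           (between? b x c)
            | indicator-yes (<-trans x<b b<c) (x <? c) = ≤-refl
    ... | tri≈ x≮b x≡b _
      rewrite indicator-no x≮b (x <? b) | indicator-no (λ btw → Between⇒≢ˡ btw x≡b) (between? b x c) = z≤n
    ... | tri> x≮b _ b<x rewrite indicator-no x≮b (x <? b) with between? b x c
    ...   | no _                  = z≤n
    ...   | yes (inj₁ (_ , x<c))  rewrite indicator-yes x<c (x <? c) = ≤-refl
    ...   | yes (inj₂ (_ , x<b))  = ⊥-elim (x≮b x<b)

  -- u is counted in rank v but neither in rank u nor between f u and f v.
  rank-gap : ∀ {u v} → f u < f v → rank u + countBetween f (f u) (f v) (vertices t) < rank v
  rank-gap {u} {v} fu<fv = begin-strict
      rank u + countBetween f (f u) (f v) (vertices t)
    ≡⟨ sym (sum-map-+ (λ w → indicator (f w <? f u)) (λ w → indicator (between? (f u) (f w) (f v))) (vertices t)) ⟩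
      sum (map (λ w → indicator (f w <? f u) + indicator (between? (f u) (f w) (f v))) (vertices t))
    <⟨ sum-map-< (vertices t) (λ w → indicator-split fu<fv (f w)) (∈-vertices u) u-counted ⟩
      rank v
    ∎
    where
    open ≤-Reasoning
    u-counted : indicator (f u <? f u) + indicator (between? (f u) (f u) (f v)) < indicator (f u <? f v)
    u-counted rewrite indicator-no (<-irrefl refl) (f u <? f u)
                    | indicator-no (λ btw → Between⇒≢ˡ btw refl) (between? (f u) (f u) (f v))
                    | indicator-yes fu<fv (f u <? f v) = ≤-refl

  rank-mono : ∀ {u v} → f u < f v → rank u < rank v
  rank-mono fu<fv = ≤-<-trans (m≤m+n _ _) (rank-gap fu<fv)

  rank-reflects : ∀ {u v} → rank u < rank v → f u < f v
  rank-reflects {u} {v} ru<rv with <-cmp (f u) (f v)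
  ... | tri< fu<fv _ _ = fu<fv
  ... | tri≈ _ fu≡fv _ rewrite f-inj fu≡fv = ⊥-elim (<-irrefl refl ru<rv)
  ... | tri> _ _ fv<fu = ⊥-elim (<-asym ru<rv (rank-mono fv<fu))

  rank-injective : Injective _≡_ _≡_ rank
  rank-injective {u} {v} ru≡rv with <-cmp (f u) (f v)
  ... | tri< fu<fv _ _ = ⊥-elim (<-irrefl ru≡rv (rank-mono fu<fv))
  ... | tri≈ _ fu≡fv _ = f-inj fu≡fv
  ... | tri> _ _ fv<fu = ⊥-elim (<-irrefl (sym ru≡rv) (rank-mono fv<fu))

  π-rank : Pos t → Fin (size t)
  π-rank v = fromℕ< (rank<size v)

  toℕ-π-rank : ∀ v → toℕ (π-rank v) ≡ rank v
  toℕ-π-rank v = toℕ-fromℕ< (rank<size v)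

  π-rank-injective : Injective _≡_ _≡_ π-rank
  π-rank-injective {u} {v} eq = rank-injective (trans (sym (toℕ-π-rank u)) (trans (cong toℕ eq) (toℕ-π-rank v)))

  -- If k were missed, the size t distinct values of π-rank would all lie among
  -- the size t - 1 elements of Fin (size t) other than k.
  π-rank-surjective : ∀ k → ∃ λ v → π-rank v ≡ k
  π-rank-surjective k with Any.any? (λ v → π-rank v Fin.≟ k) (vertices t)
  ... | yes hit = Any.satisfied hit
  ... | no miss = ⊥-elim (<-irrefl refl (begin-strict
      size t
    ≡⟨ sym (trans (length-map π-rank (vertices t)) (length-vertices t)) ⟩
      length (map π-rank (vertices t))
    ≤⟨ unique⇒length≤count (λ x → ¬? (x Fin.≟ k)) (allFin (size t))
         (Unique-map⁺ π-rank-injective (vertices-unique t)) (λ _ → ∈-allFin _) (All.tabulate ≢k) ⟩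
      count (λ x → ¬? (x Fin.≟ k)) (allFin (size t))
    <⟨ count-< (λ x → ¬? (x Fin.≟ k)) (allFin (size t)) (∈-allFin k) (λ k≢k → k≢k refl) ⟩
      length (allFin (size t))
    ≡⟨ length-tabulate _ ⟩
      size t
    ∎))
    where
    open ≤-Reasoning
    ≢k : ∀ {x} → x ∈ map π-rank (vertices t) → x ≢ k
    ≢k x∈ refl with ∈-map⁻ π-rank x∈
    ... | v , v∈ , refl = miss (Any.map (λ {refl → refl}) v∈)

  rankArrangement : Arrangement t
  rankArrangement = record
    { π   = π-rank
    ; bij = π-rank-injective , λ k → proj₁ (π-rank-surjective k) , λ {refl → proj₂ (π-rank-surjective k)}
    }

  pos-rankArrangement : ∀ v → pos rankArrangement v ≡ rank v
  pos-rankArrangement = toℕ-π-rank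

  labelDist≤dist : ∀ u v → u ≢ v → labelDist f u v ≤ ∣ pos rankArrangement u - pos rankArrangement v ∣
  labelDist≤dist u v u≢v rewrite pos-rankArrangement u | pos-rankArrangement v with <-cmp (f u) (f v)
  ... | tri< fu<fv _ _ rewrite m≤n⇒∣m-n∣≡n∸m (<⇒≤ (rank-mono fu<fv)) =
    m+n≤o⇒m≤o∸n (suc _) (subst (_≤ rank v) (cong suc (+-comm (rank u) _)) (rank-gap fu<fv))
  ... | tri≈ _ fu≡fv _ = ⊥-elim (u≢v (f-inj fu≡fv))
  ... | tri> _ _ fv<fu
    rewrite m≤n⇒∣n-m∣≡n∸m (<⇒≤ (rank-mono fv<fu)) | countBetween-sym f (f u) (f v) (vertices t) =
    m+n≤o⇒m≤o∸n (suc _) (subst (_≤ rank u) (cong suc (+-comm (rank v) _)) (rank-gap fv<fu))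

  labelCost≤cost : labelCost f ≤ cost rankArrangement
  labelCost≤cost = sum-map-mono (edges t) λ e e∈ → labelDist≤dist (proj₁ e) (proj₂ e) (edges-irreflexive t e∈)

labelProjective⇒projective : ∀ {ts} (f : Pos (node ts) → ℕ) (f-inj : Injective _≡_ _≡_ f) →
  LabelProjective f → Projective (RankArrangement.rankArrangement f f-inj)
labelProjective⇒projective f f-inj (planar , root-uncovered) =
  (λ e e′ e∈ e′∈ cross → planar e e′ e∈ e′∈
    (Separates-transport (proj₁ e) (proj₂ e) (proj₁ e′) (proj₂ e′) (Crosses⇒Separates _ _ _ _ cross))) ,
  λ e e∈ (l , r) → root-uncovered e e∈ (Between-transport (proj₁ e) root (proj₂ e) (⊓<⊔⇒Between _ _ _ l r))
  where
  open RankArrangement f f-inj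
  reflects : ∀ {x y} → pos rankArrangement x < pos rankArrangement y → f x < f y
  reflects {x} {y} = rank-reflects ∘ subst₂ _<_ (pos-rankArrangement x) (pos-rankArrangement y)
  open Transport {g = pos rankArrangement} {h = f} reflects

-- The canonical labelling

-- The label c < M placed, reversed, into the block (k M, k M + M].
block : ℕ → ℕ → ℕ → ℕ
block M k c = suc (k * M + (M ∸ suc c))

block-lower : ∀ M k c → k * M < block M k c
block-lower M k c = s≤s (m≤m+n _ _)

block-upper : ∀ M k {c} → c < M → block M k c ≤ k * M + M
block-upper M k {c} c<M = ≤-trans (≤-reflexive (sym (+-suc (k * M) (M ∸ suc c))))
  (+-monoʳ-≤ (k * M) (∸-monoʳ-< {m = M} {n = suc c} {o = 0} z<s c<M))

block-zero : ∀ M k → 0 < M → block M k 0 ≡ k * M + M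
block-zero (suc M) k _ = sym (+-suc (k * suc M) M)

block-antitone : ∀ M k {c c′} → c < c′ → c′ < M → block M k c′ < block M k c
block-antitone M k c<c′ c′<M = s≤s (+-monoʳ-< (k * M) (∸-monoʳ-< {m = M} (s≤s c<c′) c′<M))

block-reflects : ∀ M k {c c′} → c < M → c′ < M → block M k c < block M k c′ → c′ < c
block-reflects M k {c} {c′} c<M c′<M lt with <-cmp c c′
... | tri< c<c′ _ _ = ⊥-elim (<-asym lt (block-antitone M k c<c′ c′<M))
... | tri≈ _ refl _ = ⊥-elim (<-irrefl refl lt)
... | tri> _ _ c′<c = c′<c

block-injective : ∀ M k {c c′} → c < M → c′ < M → block M k c ≡ block M k c′ → c ≡ c′
block-injective M k {c} {c′} c<M c′<M eq with <-cmp c c′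
... | tri< c<c′ _ _ = ⊥-elim (<-irrefl (sym eq) (block-antitone M k c<c′ c′<M))
... | tri≈ _ c≡c′ _ = c≡c′
... | tri> _ _ c′<c = ⊥-elim (<-irrefl eq (block-antitone M k c′<c c<M))

-- Among d children of a forest with S vertices, child i of size n gets the key
-- below: children with more vertices get smaller keys, ties broken by index.
key : (S d n i : ℕ) → ℕ
key S d n i = (S ∸ n) * d + i

private
  mixed-< : ∀ {d a b i j} → i < d → a < b → a * d + i < b * d + j
  mixed-< {d} {a} {b} {i} {j} i<d a<b = <-≤-trans (+-monoʳ-< (a * d) i<d)
    (≤-trans (≤-reflexive (+-comm (a * d) d)) (≤-trans (*-monoˡ-≤ d a<b) (m≤m+n _ _)))

key-injective : ∀ {S d n n′ i j} → i < d → j < d → key S d n i ≡ key S d n′ j → i ≡ j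
key-injective {S} {d} {n} {n′} {i} {j} i<d j<d eq with <-cmp (S ∸ n) (S ∸ n′)
... | tri< lt _ _   = ⊥-elim (<-irrefl eq (mixed-< i<d lt))
... | tri> _ _ gt   = ⊥-elim (<-irrefl (sym eq) (mixed-< j<d gt))
... | tri≈ _ same _ rewrite same = +-cancelˡ-≡ ((S ∸ n′) * d) i j eq

key-< : ∀ S {d} n {i} → i < d → key S d n i < suc S * d
key-< S {d} n {i} i<d = <-≤-trans (+-monoʳ-< ((S ∸ n) * d) i<d)
  (≤-trans (≤-reflexive (+-comm ((S ∸ n) * d) d)) (*-monoˡ-≤ d (s≤s (m∸n≤m S n))))

key-antitone : ∀ {S d n n′ i j} → i < d → n ≤ S → key S d n′ j < key S d n i → n ≤ n′
key-antitone {S} {d} {n} {n′} {i} {j} i<d n≤S lt with <-cmp n′ n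
... | tri≈ _ n′≡n _ = ≤-reflexive (sym n′≡n)
... | tri> _ _ n<n′ = <⇒≤ n<n′
... | tri< n′<n _ _ = ⊥-elim (<-asym lt (mixed-< i<d (∸-monoʳ-< n′<n n≤S)))

-- The root gets label 0 and the immediate subtrees get blocks of a common
-- width to its right, ordered by key; each block carries the subtree's own
-- canonical labelling reversed, so that its root sits at the far end.
mutual
  labelBound : Tree → ℕ
  labelBound (node ts) = suc (suc (sizes ts) * length ts * labelBoundF ts)

  labelBoundF : List Tree → ℕ
  labelBoundF []       = 0
  labelBoundF (t ∷ ts) = labelBound t + labelBoundF ts

mutual
  canon : (t : Tree) → Pos t → ℕ
  canon (node ts) root    = 0
  canon (node ts) (sub a) = canonF (sizes ts) (length ts) (labelBoundF ts) ts 0 a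

  canonF : (S d M : ℕ) (us : List Tree) → ℕ → Any Pos us → ℕ
  canonF S d M (u ∷ us) i (here w)  = block M (key S d (size u) i) (canon u w)
  canonF S d M (u ∷ us) i (there a) = canonF S d M us (suc i) a

canonF-embed : ∀ S d M us i (j : Fin (length us)) w →
  canonF S d M us i (embed j w) ≡ block M (key S d (size (lookup us j)) (i + toℕ j)) (canon (lookup us j) w)
canonF-embed S d M (u ∷ us) i zero    w rewrite +-identityʳ i = refl
canonF-embed S d M (u ∷ us) i (suc j) w rewrite +-suc i (toℕ j) = canonF-embed S d M us (suc i) j w

labelBound≤labelBoundF : ∀ ts i → labelBound (lookup ts i) ≤ labelBoundF ts
labelBound≤labelBoundF (t ∷ ts) zero    = m≤m+n _ _
labelBound≤labelBoundF (t ∷ ts) (suc i) = ≤-trans (labelBound≤labelBoundF ts i) (m≤n+m _ _)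

size≤sizes : ∀ ts i → size (lookup ts i) ≤ sizes ts
size≤sizes (t ∷ ts) zero    = m≤m+n _ _
size≤sizes (t ∷ ts) (suc i) = ≤-trans (size≤sizes ts i) (m≤n+m _ _)

size≤suc-countBetween : ∀ t (g : Pos t → ℕ) a b → (∀ w → w ≢ rootOf t → Between a (g w) b) →
  size t ≤ suc (countBetween g a b (vertices t))
size≤suc-countBetween (node ts) g a b inside = s≤s (begin
    sizes ts
  ≡⟨ sym (trans (length-map sub (forestVertices ts)) (length-forestVertices ts)) ⟩
    length (map sub (forestVertices ts))
  ≡⟨ sym (count-all _ (map sub (forestVertices ts)) non-root) ⟩
    countBetween g a b (map sub (forestVertices ts))
  ≤⟨ m≤n+m _ _ ⟩
    countBetween g a b (vertices (node ts))
  ∎)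
  where
  open ≤-Reasoning
  non-root : ∀ v → v ∈ map sub (forestVertices ts) → Between a (g v) b
  non-root v v∈ with ∈-map⁻ sub v∈
  ... | c , _ , refl = inside (sub c) λ ()

record CanonicalProperties (t : Tree) : Set where
  field
    root-zero      : canon t (rootOf t) ≡ 0
    bounded        : ∀ v → canon t v < labelBound t
    injective      : Injective _≡_ _≡_ (canon t)
    projective     : LabelProjective (canon t)
    Dmax≤labelCost : Dmax t ≤ labelCost (canon t)

module CanonicalNode (ts : List Tree) (ih : ∀ i → CanonicalProperties (lookup ts i)) where

  open CanonicalProperties

  private
    S d M : ℕ
    S = sizes ts
    d = length ts
    M = labelBoundF ts

  f : Pos (node ts) → ℕ
  f = canon (node ts)

  g : ∀ i → Pos (lookup ts i) → ℕ
  g i = canon (lookup ts i)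

  n : Fin d → ℕ
  n i = size (lookup ts i)

  k : Fin d → ℕ
  k i = key S d (n i) (toℕ i)

  lo hi : Fin d → ℕ
  lo i = k i * M
  hi i = k i * M + M

  g<M : ∀ i w → g i w < M
  g<M i w = <-≤-trans (bounded (ih i) w) (labelBound≤labelBoundF ts i)

  0<M : Fin d → 0 < M
  0<M i = ≤-<-trans z≤n (g<M i (rootOf (lookup ts i)))

  f-child : ∀ i w → restrict f i w ≡ block M (k i) (g i w)
  f-child = canonF-embed S d M ts 0

  f-child-range : ∀ i w → lo i < restrict f i w × restrict f i w ≤ hi i
  f-child-range i w rewrite f-child i w = block-lower M (k i) (g i w) , block-upper M (k i) (g<M i w)

  0<f-child : ∀ i w → 0 < restrict f i w
  0<f-child i w = ≤-<-trans z≤n (proj₁ (f-child-range i w))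

  f-childRoot : ∀ i → f (childRoot ts i) ≡ hi i
  f-childRoot i rewrite f-child i (rootOf (lookup ts i)) | root-zero (ih i) = block-zero M (k i) (0<M i)

  f-child-<hi : ∀ i w → w ≢ rootOf (lookup ts i) → restrict f i w < hi i
  f-child-<hi i w w≢root rewrite f-child i w =
    <-≤-trans (block-antitone M (k i) 0<g (g<M i w)) (≤-reflexive (block-zero M (k i) (0<M i)))
    where
    0<g : 0 < g i w
    0<g with g i w ≟ 0
    ... | yes ≡0 = ⊥-elim (w≢root (injective (ih i) (trans ≡0 (sym (root-zero (ih i))))))
    ... | no ≢0  = n≢0⇒n>0 ≢0

  k-injective : ∀ {i j} → k i ≡ k j → i ≡ j
  k-injective {i} {j} eq = toℕ-injective (key-injective {S} {d} {n i} {n j} (toℕ<n i) (toℕ<n j) eq)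

  hi≤lo : ∀ {i j} → k i < k j → hi i ≤ lo j
  hi≤lo {i} lt = ≤-trans (≤-reflexive (+-comm (k i * M) M)) (*-monoˡ-≤ M lt)

  apart : ∀ i j → i ≢ j → ∀ w → restrict f j w ≤ lo i ⊎ hi i < restrict f j w
  apart i j i≢j w with <-cmp (k i) (k j)
  ... | tri< ki<kj _ _ = inj₂ (≤-<-trans (hi≤lo ki<kj) (proj₁ (f-child-range j w)))
  ... | tri≈ _ ki≡kj _ = ⊥-elim (i≢j (k-injective ki≡kj))
  ... | tri> _ _ kj<ki = inj₁ (≤-trans (proj₂ (f-child-range j w)) (hi≤lo kj<ki))

  inside-block : ∀ i x y {z} → Between (restrict f i x) z (restrict f i y) → lo i < z × z < hi i
  inside-block i x y (inj₁ (x<z , z<y)) =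
    <-trans (proj₁ (f-child-range i x)) x<z , <-≤-trans z<y (proj₂ (f-child-range i y))
  inside-block i x y (inj₂ (y<z , z<x)) =
    <-trans (proj₁ (f-child-range i y)) y<z , <-≤-trans z<x (proj₂ (f-child-range i x))

  outside-block : ∀ i x y {z} → z ≤ lo i ⊎ hi i < z → ¬ Between (restrict f i x) z (restrict f i y)
  outside-block i x y (inj₁ z≤lo) btw = <-irrefl refl (<-≤-trans (proj₁ (inside-block i x y btw)) z≤lo)
  outside-block i x y (inj₂ hi<z) btw = <-asym hi<z (proj₂ (inside-block i x y btw))

  f-injective : Injective _≡_ _≡_ f
  f-injective {u} {v} eq with vertexView u | vertexView v
  ... | isRoot      | isRoot       = refl
  ... | isRoot      | inChild j w  = ⊥-elim (<-irrefl eq (0<f-child j w))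
  ... | inChild i w | isRoot       = ⊥-elim (<-irrefl (sym eq) (0<f-child i w))
  ... | inChild i w | inChild j w′ with i Fin.≟ j
  ...   | no i≢j = ⊥-elim ([ (λ ≤lo → <-irrefl (sym eq) (≤-<-trans ≤lo (proj₁ (f-child-range i w))))
                   , (λ hi< → <-irrefl eq (≤-<-trans (proj₂ (f-child-range i w)) hi<)) ]
                   (apart i j i≢j w′))
  ...   | yes refl = cong (sub ∘ embed i) (injective (ih i)
                       (block-injective M (k i) (g<M i w) (g<M i w′) (trans (sym (f-child i w)) (trans eq (f-child i w′)))))

  restrict-reverses : ∀ i {x y} → restrict f i x < restrict f i y → g i y < g i x
  restrict-reverses i {x} {y} lt rewrite f-child i x | f-child i y = block-reflects M (k i) (g<M i x) (g<M i y) lt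

  g-reverses : ∀ i {x y} → g i x < g i y → restrict f i y < restrict f i x
  g-reverses i {x} {y} lt rewrite f-child i x | f-child i y = block-antitone M (k i) lt (g<M i y)

  private
    ¬Outside-0 : ∀ {H z} → z ≤ H → ¬ Outside 0 H z
    ¬Outside-0 z≤H (inj₂ (_ , H<z)) = <-irrefl refl (<-≤-trans H<z z≤H)

    ¬Between-0 : ∀ {H z} → H ≤ z → ¬ Between 0 z H
    ¬Between-0 H≤z (inj₁ (_ , z<H)) = <-irrefl refl (<-≤-trans z<H H≤z)

    ¬Between-·0· : ∀ {x y} → ¬ Between x 0 y
    ¬Between-·0· (inj₁ (() , _))
    ¬Between-·0· (inj₂ (() , _))

  root-edge-unseparated : ∀ i j x y → ¬ (Between 0 (restrict f j x) (hi i) × Outside 0 (hi i) (restrict f j y))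
  root-edge-unseparated i j x y (btw , out) with <-cmp (k i) (k j)
  ... | tri< ki<kj _ _ = ¬Between-0 (<⇒≤ (≤-<-trans (hi≤lo ki<kj) (proj₁ (f-child-range j x)))) btw
  ... | tri≈ _ ki≡kj _ with k-injective ki≡kj
  ...   | refl = ¬Outside-0 (proj₂ (f-child-range j y)) out
  root-edge-unseparated i j x y (btw , out) | tri> _ _ kj<ki =
    ¬Outside-0 (≤-trans (proj₂ (f-child-range j y)) (≤-trans (hi≤lo kj<ki) (m≤m+n _ _))) out

  childRoot∉block : ∀ i j x y → ¬ Between (restrict f i x) (f (childRoot ts j)) (restrict f i y)
  childRoot∉block i j x y btw with i Fin.≟ j
  ... | yes refl rewrite f-childRoot i = <-irrefl refl (proj₂ (inside-block i x y btw))
  ... | no i≢j = outside-block i x y (apart i j i≢j (rootOf (lookup ts j))) btw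

  f-planar : LabelPlanar f
  f-planar e e′ e∈ e′∈ sep with edgeView ts e∈ | edgeView ts e′∈
  ... | rootEdge i | rootEdge j =
    [ (λ (btw , _) → Between⇒≢ˡ btw refl) , (λ (_ , out) → ¬Outside-0 z≤n out) ] sep
  ... | rootEdge i | subEdge j (x , y) _ rewrite f-childRoot i =
    [ root-edge-unseparated i j x y , root-edge-unseparated i j y x ] sep
  ... | subEdge i (x , y) _ | rootEdge j =
    [ (λ (btw , _) → ¬Between-·0· btw) , (λ (btw , _) → childRoot∉block i j x y btw) ] sep
  ... | subEdge i (x , y) xy∈ | subEdge j (z , w) zw∈ with i Fin.≟ j
  ...   | yes refl = proj₁ (projective (ih i)) (x , y) (z , w) xy∈ zw∈ (Separates-reverse x y z w sep)
    where open ReverseTransport (restrict-reverses i)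
  ...   | no i≢j = [ (λ (btw , _) → outside-block i x y (apart i j i≢j z) btw)
                   , (λ (btw , _) → outside-block i x y (apart i j i≢j w) btw) ] sep

  f-projective : LabelProjective f
  f-projective = f-planar , λ e e∈ btw → ¬Between-·0· btw

  f-bounded : ∀ v → f v < labelBound (node ts)
  f-bounded v with vertexView v
  ... | isRoot      = s≤s z≤n
  ... | inChild i w = s≤s (≤-trans (proj₂ (f-child-range i w))
      (≤-trans (≤-reflexive (+-comm (k i * M) M)) (*-monoˡ-≤ M (key-< S (n i) (toℕ<n i)))))

  open ProjectiveLabelling ts f f-injective f-projective using (covered; labelCost-split; rootEdges-decomposition)

  labelCost-restrict : ∀ i → labelCost (restrict f i) ≡ labelCost (g i)
  labelCost-restrict i = cong sum (map-cong (λ e → cong suc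
      (count-cong _ _ (vertices (lookup ts i)) (λ w → ToG.Between-reverse (proj₁ e) w (proj₂ e))
                                               (λ w → FromG.Between-reverse (proj₁ e) w (proj₂ e))))
    (edges (lookup ts i)))
    where
    module ToG   = ReverseTransport (restrict-reverses i)
    module FromG = ReverseTransport (g-reverses i)

  covered-diagonal : ∀ i → n i ≤ 1 + covered i i
  covered-diagonal i = size≤suc-countBetween (lookup ts i) (restrict f i) 0 (f (childRoot ts i)) λ w w≢root →
    inj₁ (0<f-child i w , subst (restrict f i w <_) (sym (f-childRoot i)) (f-child-<hi i w w≢root))

  covered-all : ∀ {i j} → k j < k i → covered i j ≡ n j
  covered-all {i} {j} kj<ki = trans (count-all _ (vertices (lookup ts j)) λ w _ →
      inj₁ (0<f-child j w , subst (restrict f j w <_) (sym (f-childRoot i))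
        (≤-<-trans (proj₂ (f-child-range j w)) (≤-<-trans (hi≤lo kj<ki) (m<m+n _ (0<M i))))))
    (length-vertices (lookup ts j))

  covered-pair-≥ : ∀ i j → i ≢ j → n i ⊔ n j ≤ covered i j + covered j i
  covered-pair-≥ i j i≢j with <-cmp (k i) (k j)
  ... | tri≈ _ ki≡kj _ = ⊥-elim (i≢j (k-injective ki≡kj))
  ... | tri> _ _ kj<ki = begin
      n i ⊔ n j    ≡⟨ m≤n⇒m⊔n≡n (key-antitone (toℕ<n i) (size≤sizes ts i) kj<ki) ⟩
      n j          ≡⟨ sym (covered-all kj<ki) ⟩
      covered i j  ≤⟨ m≤m+n _ _ ⟩
      covered i j + covered j i ∎
    where open ≤-Reasoning
  ... | tri< ki<kj _ _ = begin
      n i ⊔ n j    ≡⟨ m≥n⇒m⊔n≡m (key-antitone (toℕ<n j) (size≤sizes ts j) ki<kj) ⟩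
      n i          ≡⟨ sym (covered-all ki<kj) ⟩
      covered j i  ≤⟨ m≤n+m _ _ ⟩
      covered i j + covered j i ∎
    where open ≤-Reasoning

  rootCost≤rootEdges : rootCost (map size ts) ≤ ∑ (λ i → labelDist f root (childRoot ts i))
  rootCost≤rootEdges = begin
      rootCost (map size ts)
    ≡⟨ sym (rootCost-lookup size ts) ⟩
      ∑ n + ∑< (λ i j → n i ⊔ n j)
    ≤⟨ +-mono-≤ (∑-mono covered-diagonal) (∑<-mono covered-pair-≥) ⟩
      ∑ (λ i → 1 + covered i i) + ∑< (λ i j → covered i j + covered j i)
    ≡⟨ sym rootEdges-decomposition ⟩
      ∑ (λ i → labelDist f root (childRoot ts i))
    ∎
    where open ≤-Reasoning

  f-Dmax≤labelCost : Dmax (node ts) ≤ labelCost f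
  f-Dmax≤labelCost = begin
      DmaxF ts + rootCost (map size ts)
    ≡⟨ +-comm (DmaxF ts) _ ⟩
      rootCost (map size ts) + DmaxF ts
    ≡⟨ cong (rootCost (map size ts) +_) (DmaxF-∑ ts) ⟩
      rootCost (map size ts) + ∑ (Dmax ∘ lookup ts)
    ≤⟨ +-mono-≤ rootCost≤rootEdges (∑-mono λ i →
         ≤-trans (Dmax≤labelCost (ih i)) (≤-reflexive (sym (labelCost-restrict i)))) ⟩
      ∑ (λ i → labelDist f root (childRoot ts i)) + ∑ (λ i → labelCost (restrict f i))
    ≡⟨ sym labelCost-split ⟩
      labelCost f
    ∎
    where open ≤-Reasoning

  canonicalProperties : CanonicalProperties (node ts)
  canonicalProperties = record
    { root-zero      = refl
    ; bounded        = f-bounded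
    ; injective      = f-injective
    ; projective     = f-projective
    ; Dmax≤labelCost = f-Dmax≤labelCost
    }

canonicalProperties : ∀ t → CanonicalProperties t
canonicalProperties = tree-ind CanonicalProperties CanonicalNode.canonicalProperties

Dmax-isMaxProj : ∀ t → IsMaxProj t (Dmax t)
Dmax-isMaxProj (node ts) =
  (rankArrangement , rank-projective , ≤-antisym (maximal rankArrangement rank-projective) lower) , maximal
  where
  open CanonicalProperties (canonicalProperties (node ts))
  open RankArrangement (canon (node ts)) injective using (rankArrangement; labelCost≤cost)
  rank-projective : Projective rankArrangement
  rank-projective = labelProjective⇒projective (canon (node ts)) injective projective
  maximal : ∀ a → Projective a → cost a ≤ Dmax (node ts)
  maximal a a-proj = ≤-trans (cost≤labelCost a)
    (labelCost≤Dmax (node ts) (pos a) (pos-injective a) (projective⇒labelProjective a a-proj))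
  lower : Dmax (node ts) ≤ cost rankArrangement
  lower = ≤-trans Dmax≤labelCost labelCost≤cost

IsMaxProj-unique : ∀ {t m m′} → IsMaxProj t m → IsMaxProj t m′ → m ≡ m′
IsMaxProj-unique ((a , a-proj , refl) , a-max) ((b , b-proj , refl) , b-max) =
  ≤-antisym (b-max a a-proj) (a-max b b-proj)

IsMaxProj⇒≡Dmax : ∀ {ts ds} → Pointwise IsMaxProj ts ds → ds ≡ map Dmax ts
IsMaxProj⇒≡Dmax []               = refl
IsMaxProj⇒≡Dmax (d-max ∷ ds-max) =
  cong₂ _∷_ (IsMaxProj-unique d-max (Dmax-isMaxProj _)) (IsMaxProj⇒≡Dmax ds-max)

corollary2 : (ts ts′ : List Tree) → ts′ ↭ ts
           → Linked (λ a b → size b ≤ size a) ts′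
           → (ds : List ℕ) → Pointwise IsMaxProj ts′ ds
           → IsMaxProj (node ts) (sum ds + prefixSumsSum (map size ts′))
corollary2 ts ts′ ts′↭ts ts′↓ ds ds-max = subst (IsMaxProj (node ts)) (sym Dmax≡) (Dmax-isMaxProj (node ts))
  where
  open ≡-Reasoning
  Dmax≡ : sum ds + prefixSumsSum (map size ts′) ≡ Dmax (node ts)
  Dmax≡ = cong₂ _+_
    (begin
      sum ds                ≡⟨ cong sum (IsMaxProj⇒≡Dmax ds-max) ⟩
      sum (map Dmax ts′)    ≡⟨ sum-↭ (↭-map⁺ Dmax ts′↭ts) ⟩
      sum (map Dmax ts)     ≡⟨ sym (DmaxF-sum ts) ⟩
      DmaxF ts              ∎)
    (begin
      prefixSumsSum (map size ts′) ≡⟨ prefixSumsSum≡rootCost (map size ts′) (Linked-map⁺ ts′↓) ⟩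
      rootCost (map size ts′)      ≡⟨ rootCost-↭ (↭-map⁺ size ts′↭ts) ⟩
      rootCost (map size ts)       ∎)
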